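{- Let $k>1$ be an integer and let $N_k(e_1,e_2,p)$ denote the number of $(a_1,\dots,a_k)\in\mathbb{F}_p^k$ with $e_1(a_1,\dots,a_k)\equiv 0\pmod p$ and $e_2(a_1,\dots,a_k)\equiv 0\pmod p$. For every prime $p>2$, \[ N_k(e_1,e_2,p)=\begin{cases} p^{k-2}+(p-1)p^{(k-3)/2}\,\eta\big((-1)^{(k-1)/2}k\big), &\text{if }k\text{ is odd},\\ p^{k-2}+(p-1)p^{(k-2)/2}\,\eta\big((-1)^{k/2}(1-\gcd(k,p))\big), &\text{if }k\text{ is even}. \end{cases} \] Moreover, \[ N_k(e_1,e_2,2)=\frac{1}{4}\left(2^k+2(\sqrt{2})^k\cos\frac{k\pi}{4}\right). \]
   Context: $e_1(x_1,\dots,x_k)=\sum_i x_i$ and $e_2(x_1,\dots,x_k)=\sum_{1\le i<j\le k}x_ix_j$ are the first two elementary symmetric polynomials. For an odd prime $p$, $\eta$ denotes the quadratic character of $\mathbb{F}_p$ (Legendre symbol modulo $p$), extended by $\eta(0)=0$; its arguments are integers read modulo $p$. -}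

module Defs where

open import Data.Nat as ℕ using (ℕ; zero; suc; _≡ᵇ_)
open import Data.Nat.DivMod using (_%_)
open import Data.Bool using (Bool; true; false; _∧_; if_then_else_)
open import Data.List using (List; []; _∷_; map; concatMap; length; filterᵇ; upTo; allFin)
open import Data.Bool.ListAction using (any)
open import Data.Vec using (Vec; []; _∷_)
open import Data.Fin using (Fin; toℕ)
open import Data.Integer as ℤ using (ℤ; +_; -_; _%ℕ_)

e₁ : ∀ {k} → Vec ℕ k → ℕ
e₁ []       = 0
e₁ (x ∷ xs) = x ℕ.+ e₁ xs

e₂ : ∀ {k} → Vec ℕ k → ℕ
e₂ []       = 0
e₂ (x ∷ xs) = x ℕ.* e₁ xs ℕ.+ e₂ xs

allTuples : (p k : ℕ) → List (Vec (Fin p) k)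
allTuples p zero    = [] ∷ []
allTuples p (suc k) = concatMap (λ a → map (a ∷_) (allTuples p k)) (allFin p)

toℕs : ∀ {p k} → Vec (Fin p) k → Vec ℕ k
toℕs []       = []
toℕs (a ∷ as) = toℕ a ∷ toℕs as

N : (k p : ℕ) → ℕ
N k zero    = 0   -- junk value, never used (p is prime)
N k (suc q) =
  length (filterᵇ (λ a → ((e₁ (toℕs a) % suc q) ≡ᵇ 0) ∧ ((e₂ (toℕs a) % suc q) ≡ᵇ 0))
                  (allTuples (suc q) k))

-- quadratic character η of 𝔽_p (Legendre symbol), with η(0) = 0;
-- the integer argument is read modulo p.
η : (p : ℕ) → ℤ → ℤ
η zero    a = + 0   -- junk value, never used
η (suc q) a =
  let r = a %ℕ suc q in
  if r ≡ᵇ 0 then + 0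
  else if any (λ x → ((x ℕ.* x) % suc q) ≡ᵇ r) (upTo (suc q)) then + 1
  else - (+ 1)

-- Gaussian integers a + b i as pairs, used for (1+i)^k
-- reIpow k = Re((1+i)^k) = (√2)^k cos(kπ/4)
record ℤ[i] : Set where
  constructor _+_i
  field re im : ℤ

mulG : ℤ[i] → ℤ[i] → ℤ[i]
mulG (a + b i) (c + d i) = (a ℤ.* c ℤ.- b ℤ.* d) + (a ℤ.* d ℤ.+ b ℤ.* c) i

powOnePlusI : ℕ → ℤ[i]
powOnePlusI zero    = (+ 1) + (+ 0) i
powOnePlusI (suc k) = mulG ((+ 1) + (+ 1) i) (powOnePlusI k)

sqrt2PowCos : ℕ → ℤ
sqrt2PowCos k = ℤ[i].re (powOnePlusI k)

module Submission where

-- For odd p: once p ∣ e₁, the identity e₁² = 2e₂ + Σaᵢ² lets one replace e₂ by Σaᵢ².  Let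
-- reps k u w count the a ∈ 𝔽ₚᵏ with Σaᵢ ≡ u and Σaᵢ² ≡ w.  Splitting off one coordinate gives
-- reps (k+1) u w = Σₓ reps k (u − x) (w − x²), and by induction p · reps k u w = p^(k−1) + E,
-- where E depends only on the parity of k, on whether p ∣ k, and on the quadratic character
-- of the discriminant k·w − u².  Each induction step is a sum Σₓ η(a x² + e) or Σₓ ν(a x² + e)
-- evaluated by completing the square; when p divides k or k + 1 it degenerates into a linear
-- sum.  Specialising to u = w = 0 gives the formula.
-- For p = 2 the tuples are 0/1-vectors and (e₁, e₂) mod 2 determines the number of ones
-- mod 4.  Prepending a coordinate gives c_j(k+1) = c_j(k) + c_{j+1}(k) for the four class
-- counts, which is multiplication by 1 + i after a discrete Fourier transform.

open import Defs
open import Data.Bool using (Bool; true; false; T; if_then_else_; _∧_)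
open import Data.Bool.ListAction using (any)
open import Data.Empty using (⊥-elim)
open import Data.Fin as Fin using (Fin; toℕ; zero; suc)
open import Data.Fin.Patterns using (0F; 1F; 2F; 3F)
import Data.Fin.Properties as FinP
open import Data.Integer as ℤ using (ℤ; +_; -_; _+_; _-_; _*_; _^_; _≤_; _%ℕ_; _/ℕ_)
open import Data.Integer.DivMod using (a≡a%ℕn+[a/ℕn]*n; n%ℕd<d)
open import Data.Integer.Divisibility.Signed
  using (_∣_; divides; _∣?_; ∣ᵤ⇒∣; ∣⇒∣ᵤ; ∣m∣n⇒∣m+n; ∣m⇒∣-m; ∣m∣n⇒∣m-n; ∣n⇒∣m*n; ∣m⇒∣m*n)
import Data.Integer.Properties as ℤP
open import Data.Integer.Tactic.RingSolver using (solve-∀)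
open import Data.List using (List; []; _∷_; _++_; map; length; filterᵇ; concat; tabulate; upTo)
open import Data.List.Membership.Propositional using (lose)
open import Data.List.Membership.Propositional.Properties using (∈-upTo⁺)
import Data.List.Properties as ListP
open import Data.List.Relation.Unary.Any using (satisfied)
open import Data.List.Relation.Unary.Any.Properties using (any⁺; any⁻)
open import Data.Nat as ℕ using (ℕ; _<_; zero; suc; _≡ᵇ_; s≤s; z≤n)
open import Data.Nat.Coprimality using (Coprime; coprime-Bézout; coprime⇒gcd≡1)
open import Data.Nat.DivMod using (_%_; _/_)
import Data.Nat.DivMod as ℕDM
import Data.Nat.Divisibility as ℕD
open import Data.Nat.GCD using (gcd; gcd[m,n]∣n; gcd-greatest; module Bézout)
open import Data.Nat.Primality using (Prime; euclidsLemma; prime⇒irreducible)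
import Data.Nat.Properties as ℕP
import Data.Nat.Tactic.RingSolver as ℕSolver
open import Data.Product using (_,_; _×_; proj₁; proj₂; ∃)
open import Data.Sum using (_⊎_; inj₁; inj₂; [_,_]; [_,_]′)
open import Data.Vec using (Vec; []; _∷_)
open import Function using (_∘_; _$_; id)
open import Function.Bundles using (_⇔_; mk⇔)
open import Relation.Binary.PropositionalEquality
  using (_≡_; refl; sym; trans; cong; cong₂; subst; subst₂; module ≡-Reasoning)
open import Relation.Nullary using (¬_; Dec; yes; no; does)
open import Relation.Nullary.Decidable using (T?; dec-true; dec-false; does-⇔)

open import Algebra.Properties.Semiring.Sum ℤP.+-*-semiring
  using (sum; sum-syntax; sum-cong-≗; ∑-distrib-+; ∑-comm; *-distribˡ-sum; sum-init-last)

sum-const : ∀ n c → ∑[ j < n ] c ≡ + n * c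
sum-const zero    c = sym (ℤP.*-zeroˡ c)
sum-const (suc n) c = begin
  c + ∑[ j < n ] c    ≡⟨ cong (_+_ c) (sum-const n c) ⟩
  c + + n * c         ≡⟨ ℤP.suc-* (+ n) c ⟨
  + suc n * c         ∎
  where open ≡-Reasoning

sum-nonpos : ∀ {n} (f : Fin n → ℤ) → (∀ j → f j ≤ + 0) → sum f ≤ + 0
sum-nonpos {zero}  f f≤0 = ℤP.≤-refl
sum-nonpos {suc n} f f≤0 = ℤP.+-mono-≤ (f≤0 zero) (sum-nonpos (f ∘ suc) (f≤0 ∘ suc))

nonpos-+≡0⇒≡0 : ∀ {x y} → x ≤ + 0 → y ≤ + 0 → x + y ≡ + 0 → x ≡ + 0
nonpos-+≡0⇒≡0 {x} x≤0 y≤0 x+y≡0 =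
  ℤP.≤-antisym x≤0 (subst₂ _≤_ x+y≡0 (ℤP.+-identityʳ x) (ℤP.+-monoʳ-≤ x y≤0))

sum-nonpos-zero : ∀ {n} (f : Fin n → ℤ) → (∀ j → f j ≤ + 0) → sum f ≡ + 0 → ∀ j → f j ≡ + 0
sum-nonpos-zero {suc n} f f≤0 sum≡0 zero =
  nonpos-+≡0⇒≡0 (f≤0 zero) (sum-nonpos (f ∘ suc) (f≤0 ∘ suc)) sum≡0
sum-nonpos-zero {suc n} f f≤0 sum≡0 (suc j) =
  sum-nonpos-zero (f ∘ suc) (f≤0 ∘ suc)
    (nonpos-+≡0⇒≡0 (sum-nonpos (f ∘ suc) (f≤0 ∘ suc)) (f≤0 zero)
      (trans (ℤP.+-comm _ (f zero)) sum≡0)) j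

length-filterᵇ-map : ∀ {A B : Set} (f : B → Bool) (h : A → B) xs →
  length (filterᵇ f (map h xs)) ≡ length (filterᵇ (f ∘ h) xs)
length-filterᵇ-map f h []       = refl
length-filterᵇ-map f h (x ∷ xs) with f (h x)
... | true  = cong suc (length-filterᵇ-map f h xs)
... | false = length-filterᵇ-map f h xs

length-filterᵇ-concat : ∀ {A : Set} (f : A → Bool) {n} (t : Fin n → List A) →
  + length (filterᵇ f (concat (tabulate t))) ≡ ∑[ j < n ] (+ length (filterᵇ f (t j)))
length-filterᵇ-concat f {zero}  t = refl
length-filterᵇ-concat f {suc n} t = begin
  + length (filterᵇ f (t zero ++ rest))
    ≡⟨ cong (+_ ∘ length) (ListP.filter-++ (T? ∘ f) (t zero) rest) ⟩
  + length (filterᵇ f (t zero) ++ filterᵇ f rest)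
    ≡⟨ cong +_ (ListP.length-++ (filterᵇ f (t zero))) ⟩
  + (length (filterᵇ f (t zero)) ℕ.+ length (filterᵇ f rest))
    ≡⟨ ℤP.pos-+ (length (filterᵇ f (t zero))) _ ⟩
  + length (filterᵇ f (t zero)) + + length (filterᵇ f rest)
    ≡⟨ cong (_+_ (+ length (filterᵇ f (t zero)))) (length-filterᵇ-concat f (t ∘ suc)) ⟩
  ∑[ j < suc n ] (+ length (filterᵇ f (t j))) ∎
  where
  open ≡-Reasoning
  rest = concat (tabulate (t ∘ suc))

count : (p k : ℕ) → (Vec ℕ k → Bool) → ℕ
count p k Q = length (filterᵇ (Q ∘ toℕs) (allTuples p k))

count-cong : ∀ p k {Q R : Vec ℕ k → Bool} → (∀ v → Q v ≡ R v) → count p k Q ≡ count p k R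
count-cong p k {Q} {R} Q≗R = cong length
  (ListP.filter-≐ (T? ∘ Q ∘ toℕs) (T? ∘ R ∘ toℕs)
    ((λ {v} → subst T (Q≗R (toℕs v))) , (λ {v} → subst T (sym (Q≗R (toℕs v)))))
    (allTuples p k))

count-suc : ∀ p k (Q : Vec ℕ (suc k) → Bool) →
  + count p (suc k) Q ≡ ∑[ x < p ] (+ count p k (λ v → Q (toℕ x ∷ v)))
count-suc p k Q = begin
  + length (filterᵇ (Q ∘ toℕs) (concat (map extend (tabulate id))))
    ≡⟨ cong (+_ ∘ length ∘ filterᵇ (Q ∘ toℕs) ∘ concat) (ListP.map-tabulate id extend) ⟩
  + length (filterᵇ (Q ∘ toℕs) (concat (tabulate extend)))
    ≡⟨ length-filterᵇ-concat (Q ∘ toℕs) extend ⟩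
  ∑[ x < p ] (+ length (filterᵇ (Q ∘ toℕs) (extend x)))
    ≡⟨ sum-cong-≗ (λ x → cong +_ (length-filterᵇ-map (Q ∘ toℕs) (x ∷_) (allTuples p k))) ⟩
  ∑[ x < p ] (+ count p k (λ v → Q (toℕ x ∷ v))) ∎
  where
  open ≡-Reasoning
  extend : Fin p → List (Vec (Fin p) (suc k))
  extend x = map (x ∷_) (allTuples p k)

count-zero : ∀ p (Q : Vec ℕ 0 → Bool) → + count p 0 Q ≡ (if Q [] then + 1 else + 0)
count-zero p Q with Q []
... | true  = refl
... | false = refl

sumSq : ∀ {k} → Vec ℕ k → ℕ
sumSq []       = 0
sumSq (x ∷ xs) = x ℕ.* x ℕ.+ sumSq xs

e₁²≡2e₂+sumSq : ∀ {k} (v : Vec ℕ k) → e₁ v ℕ.* e₁ v ≡ 2 ℕ.* e₂ v ℕ.+ sumSq v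
e₁²≡2e₂+sumSq []       = refl
e₁²≡2e₂+sumSq (x ∷ xs) = begin
  (x ℕ.+ e₁ xs) ℕ.* (x ℕ.+ e₁ xs)
    ≡⟨ expand x (e₁ xs) ⟩
  x ℕ.* x ℕ.+ 2 ℕ.* x ℕ.* e₁ xs ℕ.+ e₁ xs ℕ.* e₁ xs
    ≡⟨ cong (x ℕ.* x ℕ.+ 2 ℕ.* x ℕ.* e₁ xs ℕ.+_) (e₁²≡2e₂+sumSq xs) ⟩
  x ℕ.* x ℕ.+ 2 ℕ.* x ℕ.* e₁ xs ℕ.+ (2 ℕ.* e₂ xs ℕ.+ sumSq xs)
    ≡⟨ regroup x (e₁ xs) (e₂ xs) (sumSq xs) ⟩
  2 ℕ.* (x ℕ.* e₁ xs ℕ.+ e₂ xs) ℕ.+ (x ℕ.* x ℕ.+ sumSq xs) ∎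
  where
  open ≡-Reasoning
  expand : ∀ x e → (x ℕ.+ e) ℕ.* (x ℕ.+ e) ≡ x ℕ.* x ℕ.+ 2 ℕ.* x ℕ.* e ℕ.+ e ℕ.* e
  expand = ℕSolver.solve-∀
  regroup : ∀ x e f g → x ℕ.* x ℕ.+ 2 ℕ.* x ℕ.* e ℕ.+ (2 ℕ.* f ℕ.+ g) ≡ 2 ℕ.* (x ℕ.* e ℕ.+ f) ℕ.+ (x ℕ.* x ℕ.+ g)
  regroup = ℕSolver.solve-∀

pos-^ : ∀ a n → + (a ℕ.^ n) ≡ (+ a) ^ n
pos-^ a zero    = refl
pos-^ a (suc n) = trans (ℤP.pos-* a (a ℕ.^ n)) (cong (_*_ (+ a)) (pos-^ a n))

pos-+1 : ∀ n → + n + + 1 ≡ + suc n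
pos-+1 n = cong +_ (ℕP.+-comm n 1)

2*suc : ∀ m → 2 ℕ.* suc m ≡ 2 ℕ.+ 2 ℕ.* m
2*suc = ℕSolver.solve-∀

[2m]/2≡m : ∀ m → 2 ℕ.* m / 2 ≡ m
[2m]/2≡m m = trans (cong (_/ 2) (ℕP.*-comm 2 m)) (ℕDM.m*n/n≡m m 2)

[2+2m]/2≡1+m : ∀ m → (2 ℕ.+ 2 ℕ.* m) / 2 ≡ suc m
[2+2m]/2≡1+m m = trans (cong (_/ 2) (sym (2*suc m))) ([2m]/2≡m (suc m))

odd-decomposition : ∀ k → 1 < k → k % 2 ≡ 1 → ∃ λ m → k ≡ 3 ℕ.+ 2 ℕ.* m
odd-decomposition k 1<k k%2≡1 = by-half (k / 2) (trans (ℕDM.m≡m%n+[m/n]*n k 2) (cong (ℕ._+ (k / 2) ℕ.* 2) k%2≡1))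
  where
  by-half : ∀ h → k ≡ 1 ℕ.+ h ℕ.* 2 → ∃ λ m → k ≡ 3 ℕ.+ 2 ℕ.* m
  by-half zero    k≡1 = ⊥-elim (ℕP.<-irrefl (sym k≡1) 1<k)
  by-half (suc m) k≡  = m , trans k≡ (ring m)
    where ring : ∀ m → 1 ℕ.+ suc m ℕ.* 2 ≡ 3 ℕ.+ 2 ℕ.* m
          ring = ℕSolver.solve-∀

even-decomposition : ∀ k → 1 < k → k % 2 ≡ 0 → ∃ λ m → k ≡ 2 ℕ.+ 2 ℕ.* m
even-decomposition k 1<k k%2≡0 = by-half (k / 2) (trans (ℕDM.m≡m%n+[m/n]*n k 2) (cong (ℕ._+ (k / 2) ℕ.* 2) k%2≡0))
  where
  by-half : ∀ h → k ≡ h ℕ.* 2 → ∃ λ m → k ≡ 2 ℕ.+ 2 ℕ.* m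
  by-half zero    k≡0 = ⊥-elim (ℕP.<⇒≢ (ℕP.<-trans (s≤s z≤n) 1<k) (sym k≡0))
  by-half (suc m) k≡  = m , trans k≡ (ring m)
    where ring : ∀ m → suc m ℕ.* 2 ≡ 2 ℕ.+ 2 ℕ.* m
          ring = ℕSolver.solve-∀

-- p is taken in the form suc q, so that η p and N k p compute.
module OddPrime (q : ℕ) (p-prime : Prime (suc q)) (2<p : 2 < suc q) where

  p : ℕ
  p = suc q

  P : ℤ
  P = + p

  infix 4 _≈_
  record _≈_ (a b : ℤ) : Set where
    constructor mk≈
    field p∣a-b : P ∣ a - b
  open _≈_

  ≈-via : ∀ {a b t} z → P ∣ t → a - b ≡ z * t → a ≈ b
  ≈-via z p∣t eq = mk≈ (subst (P ∣_) (sym eq) (∣n⇒∣m*n z p∣t))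

  p∣P : P ∣ P
  p∣P = divides (+ 1) (sym (ℤP.*-identityˡ P))

  p∣0 : P ∣ + 0
  p∣0 = divides (+ 0) refl

  ≈-reflexive : ∀ {a b} → a ≡ b → a ≈ b
  ≈-reflexive {a} refl = mk≈ (subst (P ∣_) (sym (ℤP.+-inverseʳ a)) p∣0)

  ≈-refl : ∀ {a} → a ≈ a
  ≈-refl = ≈-reflexive refl

  ≈-sym : ∀ {a b} → a ≈ b → b ≈ a
  ≈-sym {a} {b} (mk≈ d) = ≈-via (- + 1) d (identity a b)
    where identity : ∀ a b → b - a ≡ - + 1 * (a - b)
          identity = solve-∀

  ≈-trans : ∀ {a b c} → a ≈ b → b ≈ c → a ≈ c
  ≈-trans {a} {b} {c} (mk≈ d) (mk≈ e) = mk≈ (subst (P ∣_) (identity a b c) (∣m∣n⇒∣m+n d e))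
    where identity : ∀ a b c → (a - b) + (b - c) ≡ a - c
          identity = solve-∀

  +-cong : ∀ {a b c d} → a ≈ b → c ≈ d → a + c ≈ b + d
  +-cong {a} {b} {c} {d} (mk≈ x) (mk≈ y) = mk≈ (subst (P ∣_) (identity a b c d) (∣m∣n⇒∣m+n x y))
    where identity : ∀ a b c d → (a - b) + (c - d) ≡ (a + c) - (b + d)
          identity = solve-∀

  *-cong : ∀ {a b c d} → a ≈ b → c ≈ d → a * c ≈ b * d
  *-cong {a} {b} {c} {d} (mk≈ x) (mk≈ y) =
    mk≈ (subst (P ∣_) (identity a b c d) (∣m∣n⇒∣m+n (∣m⇒∣m*n c x) (∣n⇒∣m*n b y)))
    where identity : ∀ a b c d → (a - b) * c + b * (c - d) ≡ a * c - b * d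
          identity = solve-∀

  -‿cong : ∀ {a b} → a ≈ b → - a ≈ - b
  -‿cong {a} {b} a≈b = subst₂ _≈_ (ℤP.-1*i≡-i a) (ℤP.-1*i≡-i b) (*-cong (≈-refl { - + 1}) a≈b)

  p∣-resp-≈ : ∀ {a b} → a ≈ b → P ∣ a → P ∣ b
  p∣-resp-≈ {a} {b} (mk≈ d) p∣a = subst (P ∣_) (identity a b) (∣m∣n⇒∣m-n p∣a d)
    where identity : ∀ a b → a - (a - b) ≡ b
          identity = solve-∀

  p∣⇒≈0 : ∀ {a} → P ∣ a → a ≈ + 0
  p∣⇒≈0 {a} p∣a = mk≈ (subst (P ∣_) (sym (ℤP.+-identityʳ a)) p∣a)

  residue-unique-≤ : ∀ {r s} → r ℕ.≤ s → s ℕ.< p → P ∣ + r - + s → r ≡ s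
  residue-unique-≤ {r} {s} r≤s s<p p∣r-s = ℕP.≤-antisym r≤s (ℕP.m∸n≡0⇒m≤n s∸r≡0)
    where
    p∣s∸r : p ℕD.∣ s ℕ.∸ r
    p∣s∸r = subst (p ℕD.∣_) (ℤP.∣⊖∣-≤ r≤s)
              (subst (λ z → p ℕD.∣ ℤ.∣ z ∣) (ℤP.[+m]-[+n]≡m⊖n r s) (∣⇒∣ᵤ p∣r-s))
    s∸r≡0 : s ℕ.∸ r ≡ 0
    s∸r≡0 = trans (sym (ℕDM.m<n⇒m%n≡m (ℕP.≤-<-trans (ℕP.m∸n≤m s r) s<p)))
                  (ℕD.n∣m⇒m%n≡0 _ p p∣s∸r)

  residue-unique : ∀ {r s} → r ℕ.< p → s ℕ.< p → P ∣ + r - + s → r ≡ s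
  residue-unique {r} {s} r<p s<p p∣r-s with ℕP.≤-total r s
  ... | inj₁ r≤s = residue-unique-≤ r≤s s<p p∣r-s
  ... | inj₂ s≤r = sym (residue-unique-≤ s≤r r<p (p∣a-b (≈-sym {+ r} {+ s} (mk≈ p∣r-s))))

  %ℕ-≈ : ∀ a → + (a %ℕ p) ≈ a
  %ℕ-≈ a = ≈-via (- (a /ℕ p)) p∣P (trans (cong (_-_ (+ r)) (a≡a%ℕn+[a/ℕn]*n a p)) (ring (+ r) (a /ℕ p) P))
    where
    r = a %ℕ p
    ring : ∀ r q P → r - (r + q * P) ≡ - q * P
    ring = solve-∀

  ≈⇒%ℕ≡ : ∀ {a b} → a ≈ b → a %ℕ p ≡ b %ℕ p
  ≈⇒%ℕ≡ {a} {b} a≈b = residue-unique (n%ℕd<d a p) (n%ℕd<d b p)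
    (p∣a-b (≈-trans (%ℕ-≈ a) (≈-trans a≈b (≈-sym (%ℕ-≈ b)))))

  %ℕ≡⇒≈ : ∀ {a b} → a %ℕ p ≡ b %ℕ p → a ≈ b
  %ℕ≡⇒≈ {a} {b} eq = ≈-trans (≈-sym (%ℕ-≈ a)) (subst (λ r → + r ≈ b) (sym eq) (%ℕ-≈ b))

  -- δ and ∑ₚ are abstract so that unification never unfolds the decision procedure or the sum.
  abstract
    δ : ℤ → ℤ
    δ a = if does (P ∣? a) then + 1 else + 0

    δ-p∣ : ∀ {a} → P ∣ a → δ a ≡ + 1
    δ-p∣ {a} p∣a = cong (if_then + 1 else + 0) (dec-true (P ∣? a) p∣a)

    δ-p∤ : ∀ {a} → ¬ P ∣ a → δ a ≡ + 0
    δ-p∤ {a} p∤a = cong (if_then + 1 else + 0) (dec-false (P ∣? a) p∤a)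

    δ-⇔ : ∀ {a b} → (P ∣ a → P ∣ b) → (P ∣ b → P ∣ a) → δ a ≡ δ b
    δ-⇔ {a} {b} to from = cong (if_then + 1 else + 0) (does-⇔ (mk⇔ to from) (P ∣? a) (P ∣? b))

    δ-does : ∀ a → δ a ≡ (if does (P ∣? a) then + 1 else + 0)
    δ-does a = refl

  δ-resp-≈ : ∀ {a b} → a ≈ b → δ a ≡ δ b
  δ-resp-≈ a≈b = δ-⇔ (p∣-resp-≈ a≈b) (p∣-resp-≈ (≈-sym a≈b))

  δ-neg : ∀ a → δ (- a) ≡ δ a
  δ-neg a = δ-⇔ (subst (P ∣_) (ℤP.neg-involutive a) ∘ ∣m⇒∣-m) ∣m⇒∣-m

  p∣*⇒p∣⊎p∣ : ∀ a b → P ∣ a * b → P ∣ a ⊎ P ∣ b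
  p∣*⇒p∣⊎p∣ a b p∣ab with euclidsLemma ℤ.∣ a ∣ ℤ.∣ b ∣ p-prime (subst (p ℕD.∣_) (ℤP.abs-* a b) (∣⇒∣ᵤ p∣ab))
  ... | inj₁ p∣a = inj₁ (∣ᵤ⇒∣ p∣a)
  ... | inj₂ p∣b = inj₂ (∣ᵤ⇒∣ p∣b)

  p∤* : ∀ {a b} → ¬ P ∣ a → ¬ P ∣ b → ¬ P ∣ a * b
  p∤* {a} {b} p∤a p∤b p∣ab = [ p∤a , p∤b ] (p∣*⇒p∣⊎p∣ a b p∣ab)

  p∣*-cancelˡ : ∀ {a b} → ¬ P ∣ a → P ∣ a * b → P ∣ b
  p∣*-cancelˡ {a} {b} p∤a p∣ab = [ ⊥-elim ∘ p∤a , id ] (p∣*⇒p∣⊎p∣ a b p∣ab)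

  p∣-neg⁻ : ∀ {a} → P ∣ - a → P ∣ a
  p∣-neg⁻ {a} = subst (P ∣_) (ℤP.neg-involutive a) ∘ ∣m⇒∣-m

  p∤small : ∀ n → 0 < n → n < p → ¬ P ∣ + n
  p∤small (suc n) _ n<p p∣n = ℕP.<⇒≱ n<p (ℕD.∣⇒≤ (∣⇒∣ᵤ p∣n))

  p∤1 : ¬ P ∣ + 1
  p∤1 = p∤small 1 (s≤s z≤n) (ℕP.<-trans (s≤s (s≤s z≤n)) 2<p)

  p∤2 : ¬ P ∣ + 2
  p∤2 = p∤small 2 (s≤s z≤n) 2<p

  coprime : ∀ {n} → ¬ P ∣ + n → Coprime n p
  coprime p∤n (d∣n , d∣p) with prime⇒irreducible p-prime d∣p
  ... | inj₁ d≡1  = d≡1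
  ... | inj₂ refl = ⊥-elim (p∤n (∣ᵤ⇒∣ d∣n))

  inverse : ∀ {a} → ¬ P ∣ a → ∃ λ c → a * c ≈ + 1
  inverse {a} p∤a = c , ≈-trans (*-cong (≈-sym (%ℕ-≈ a)) ≈-refl) r*c≈1
    where
    r = a %ℕ p
    p∤r : ¬ P ∣ + r
    p∤r = p∤a ∘ p∣-resp-≈ (%ℕ-≈ a)
    bézout : ∃ λ c → + r * c ≈ + 1
    bézout with coprime-Bézout (coprime p∤r)
    ... | Bézout.+- x y eq = + x , ≈-via (+ y) p∣P (begin
      + r * + x - + 1          ≡⟨ cong (_- + 1) (trans (sym (ℤP.pos-* r x)) (cong +_ (ℕP.*-comm r x))) ⟩
      + (x ℕ.* r) - + 1        ≡⟨ cong (λ z → + z - + 1) (sym eq) ⟩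
      + (y ℕ.* p)              ≡⟨ ℤP.pos-* y p ⟩
      + y * P                  ∎)
      where open ≡-Reasoning
    ... | Bézout.-+ x y eq = - + x , ≈-via (- + y) p∣P (begin
      + r * - + x - + 1        ≡⟨ ring (+ r) (+ x) ⟩
      - (+ 1 + + x * + r)      ≡⟨ cong (λ z → - (+ 1 + z)) (sym (ℤP.pos-* x r)) ⟩
      - + (1 ℕ.+ x ℕ.* r)      ≡⟨ cong (-_ ∘ +_) eq ⟩
      - + (y ℕ.* p)            ≡⟨ cong -_ (ℤP.pos-* y p) ⟩
      - (+ y * P)              ≡⟨ ℤP.neg-distribˡ-* (+ y) P ⟩
      - + y * P                ∎)
      where
      open ≡-Reasoning
      ring : ∀ r x → r * - x - + 1 ≡ - (+ 1 + x * r)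
      ring = solve-∀
    c = proj₁ bézout
    r*c≈1 = proj₂ bézout

  ≈0⇒p∣ : ∀ {a} → a ≈ + 0 → P ∣ a
  ≈0⇒p∣ {a} (mk≈ d) = subst (P ∣_) (ℤP.+-identityʳ a) d

  IsSquare : ℤ → Set
  IsSquare a = ∃ λ s → s * s ≈ a

  isSquareᵇ : ℕ → Bool
  isSquareᵇ r = any (λ x → ((x ℕ.* x) % p) ≡ᵇ r) (upTo p)

  -- η p a reduces to ηʳ (a %ℕ p).
  ηʳ : ℕ → ℤ
  ηʳ r = if r ≡ᵇ 0 then + 0 else if isSquareᵇ r then + 1 else - + 1

  η-resp-≈ : ∀ {a b} → a ≈ b → η p a ≡ η p b
  η-resp-≈ a≈b = cong ηʳ (≈⇒%ℕ≡ a≈b)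

  η-p∣ : ∀ {a} → P ∣ a → η p a ≡ + 0
  η-p∣ p∣a = η-resp-≈ (p∣⇒≈0 p∣a)

  SquareClass : ℤ → Set
  SquareClass a = (IsSquare a × η p a ≡ + 1) ⊎ (¬ IsSquare a × η p a ≡ - + 1)

  η-dichotomy : ∀ a → ¬ P ∣ a → SquareClass a
  η-dichotomy a p∤a with a %ℕ p ≡ᵇ 0 in r≡ᵇ0
  ... | true  = ⊥-elim (p∤a (≈0⇒p∣ (%ℕ≡⇒≈ (ℕP.≡ᵇ⇒≡ _ 0 (subst T (sym r≡ᵇ0) _)))))
  ... | false with isSquareᵇ (a %ℕ p) in square?
  ... | true  = inj₁ ((+ x , root) , refl)
    where
    found = satisfied (any⁻ _ (upTo p) (subst T (sym square?) _))
    x = proj₁ found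
    root : + x * + x ≈ a
    root = subst (_≈ a) (ℤP.pos-* x x) (%ℕ≡⇒≈ (ℕP.≡ᵇ⇒≡ _ _ (proj₂ found)))
  ... | false = inj₂ (no-root , refl)
    where
    no-root : ¬ IsSquare a
    no-root (s , s²≈a) = subst T square? (any⁺ _ (lose (∈-upTo⁺ (n%ℕd<d s p)) (ℕP.≡⇒≡ᵇ _ _ y²≡a)))
      where
      y = s %ℕ p
      y²≡a : (y ℕ.* y) % p ≡ a %ℕ p
      y²≡a = ≈⇒%ℕ≡ {+ (y ℕ.* y)} (≈-trans (subst (_≈ s * s) (sym (ℤP.pos-* y y)) (*-cong (%ℕ-≈ s) (%ℕ-≈ s))) s²≈a)

  η-residue : ∀ {a} → ¬ P ∣ a → IsSquare a → η p a ≡ + 1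
  η-residue {a} p∤a a-square = [ proj₂ , ⊥-elim ∘ (_$ a-square) ∘ proj₁ ]′ (η-dichotomy a p∤a)

  η-nonresidue : ∀ {a} → ¬ P ∣ a → ¬ IsSquare a → η p a ≡ - + 1
  η-nonresidue {a} p∤a a-nonsquare = [ ⊥-elim ∘ a-nonsquare ∘ proj₁ , proj₂ ]′ (η-dichotomy a p∤a)

  Respects≈ : (ℤ → ℤ) → Set
  Respects≈ f = ∀ {a b} → a ≈ b → f a ≡ f b

  abstract
    ∑ₚ : (ℤ → ℤ) → ℤ
    ∑ₚ f = ∑[ x < p ] (f (+ toℕ x))

    ∑ₚ-cong : ∀ {f g} → (∀ x → f x ≡ g x) → ∑ₚ f ≡ ∑ₚ g
    ∑ₚ-cong f≗g = sum-cong-≗ {p} (λ x → f≗g (+ toℕ x))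

    ∑ₚ-+ : ∀ f g → ∑ₚ (λ x → f x + g x) ≡ ∑ₚ f + ∑ₚ g
    ∑ₚ-+ f g = ∑-distrib-+ {p} (λ x → f (+ toℕ x)) (λ x → g (+ toℕ x))

    ∑ₚ-*ˡ : ∀ c f → ∑ₚ (λ x → c * f x) ≡ c * ∑ₚ f
    ∑ₚ-*ˡ c f = sym (*-distribˡ-sum {p} c (λ x → f (+ toℕ x)))

    ∑ₚ-const : ∀ c → ∑ₚ (λ _ → c) ≡ P * c
    ∑ₚ-const c = sum-const p c

    ∑ₚ-comm : ∀ (f : ℤ → ℤ → ℤ) → ∑ₚ (λ x → ∑ₚ (λ y → f x y)) ≡ ∑ₚ (λ y → ∑ₚ (λ x → f x y))
    ∑ₚ-comm f = ∑-comm {p} {p} (λ x y → f (+ toℕ x) (+ toℕ y))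

    ∑ₚ-shift-1 : ∀ f → Respects≈ f → ∑ₚ (λ x → f (x + + 1)) ≡ ∑ₚ f
    ∑ₚ-shift-1 f resp = begin
      ∑[ x < p ] (f (+ toℕ x + + 1))
        ≡⟨ sum-init-last {q} (λ x → f (+ toℕ x + + 1)) ⟩
      ∑[ x < q ] (f (+ toℕ (Fin.inject₁ x) + + 1)) + f (+ toℕ (Fin.fromℕ q) + + 1)
        ≡⟨ cong₂ _+_ (sum-cong-≗ (λ x → cong (f ∘ +_) (toℕ-inject₁+1 x))) (resp (p∣⇒≈0 p∣last)) ⟩
      ∑[ x < q ] (f (+ suc (toℕ x))) + f (+ 0)
        ≡⟨ ℤP.+-comm _ (f (+ 0)) ⟩
      ∑ₚ f ∎
      where
      open ≡-Reasoning
      toℕ-inject₁+1 : ∀ (x : Fin q) → toℕ (Fin.inject₁ x) ℕ.+ 1 ≡ suc (toℕ x)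
      toℕ-inject₁+1 x = trans (ℕP.+-comm _ 1) (cong suc (FinP.toℕ-inject₁ x))
      p∣last : P ∣ + (toℕ (Fin.fromℕ q) ℕ.+ 1)
      p∣last = subst (λ n → P ∣ + n) (sym (trans (cong (ℕ._+ 1) (FinP.toℕ-fromℕ q)) (ℕP.+-comm q 1))) p∣P

    ∑ₚ-sum : ∀ f → ∑[ x < p ] (f (+ toℕ x)) ≡ ∑ₚ f
    ∑ₚ-sum f = refl

    ∑ₚ-nonpos-zero : ∀ f → Respects≈ f → (∀ x → f x ≤ + 0) → ∑ₚ f ≡ + 0 → ∀ x → f x ≡ + 0
    ∑ₚ-nonpos-zero f resp f≤0 ∑f≡0 x = begin
      f x                ≡⟨ resp (≈-sym (%ℕ-≈ x)) ⟩
      f (+ (x %ℕ p))     ≡⟨ cong (f ∘ +_) (FinP.toℕ-fromℕ< (n%ℕd<d x p)) ⟨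
      f (+ toℕ j)        ≡⟨ sum-nonpos-zero (f ∘ +_ ∘ toℕ) (f≤0 ∘ +_ ∘ toℕ) ∑f≡0 j ⟩
      + 0                ∎
      where
      open ≡-Reasoning
      j : Fin p
      j = Fin.fromℕ< (n%ℕd<d x p)

    ∑ₚ-δ : ∑ₚ δ ≡ + 1
    ∑ₚ-δ = begin
      δ (+ 0) + ∑[ x < q ] (δ (+ suc (toℕ x)))
        ≡⟨ cong₂ _+_ (δ-p∣ p∣0) (sum-cong-≗ (λ x → δ-p∤ (p∤small _ (s≤s z≤n) (s≤s (FinP.toℕ<n x))))) ⟩
      + 1 + ∑[ x < q ] (+ 0)
        ≡⟨ cong (_+_ (+ 1)) (trans (sum-const q (+ 0)) (ℤP.*-zeroʳ (+ q))) ⟩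
      + 1 ∎
      where open ≡-Reasoning

  ∑ₚ-shift-ℕ : ∀ f → Respects≈ f → ∀ n → ∑ₚ (λ x → f (x + + n)) ≡ ∑ₚ f
  ∑ₚ-shift-ℕ f resp zero    = ∑ₚ-cong (λ x → cong f (ℤP.+-identityʳ x))
  ∑ₚ-shift-ℕ f resp (suc n) = begin
    ∑ₚ (λ x → f (x + + suc n))         ≡⟨ ∑ₚ-cong (λ x → cong f (reassoc x (+ n))) ⟩
    ∑ₚ (λ x → f (x + + 1 + + n))       ≡⟨ ∑ₚ-shift-1 (λ y → f (y + + n)) (λ a≈b → resp (+-cong a≈b ≈-refl)) ⟩
    ∑ₚ (λ y → f (y + + n))             ≡⟨ ∑ₚ-shift-ℕ f resp n ⟩
    ∑ₚ f                               ∎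
    where
    open ≡-Reasoning
    reassoc : ∀ x n → x + (+ 1 + n) ≡ x + + 1 + n
    reassoc = solve-∀

  ∑ₚ-shift : ∀ f → Respects≈ f → ∀ c → ∑ₚ (λ x → f (x + c)) ≡ ∑ₚ f
  ∑ₚ-shift f resp c =
    trans (∑ₚ-cong (λ x → resp (+-cong (≈-refl {x}) (≈-sym (%ℕ-≈ c))))) (∑ₚ-shift-ℕ f resp (c %ℕ p))

  ∑ₚ-δ-point : ∀ a → ∑ₚ (λ x → δ (x - a)) ≡ + 1
  ∑ₚ-δ-point a = trans (∑ₚ-shift δ δ-resp-≈ (- a)) ∑ₚ-δ

  δ-* : ∀ {a b} → ¬ (P ∣ a × P ∣ b) → δ (a * b) ≡ δ a + δ b
  δ-* {a} {b} not-both = cases (P ∣? a) (P ∣? b)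
    where
    cases : Dec (P ∣ a) → Dec (P ∣ b) → δ (a * b) ≡ δ a + δ b
    cases (yes p∣a) (yes p∣b) = ⊥-elim (not-both (p∣a , p∣b))
    cases (yes p∣a) (no  p∤b) = trans (δ-p∣ (∣m⇒∣m*n b p∣a)) (sym (cong₂ _+_ (δ-p∣ p∣a) (δ-p∤ p∤b)))
    cases (no  p∤a) (yes p∣b) = trans (δ-p∣ (∣n⇒∣m*n a p∣b)) (sym (cong₂ _+_ (δ-p∤ p∤a) (δ-p∣ p∣b)))
    cases (no  p∤a) (no  p∤b) = trans (δ-p∤ (p∤* p∤a p∤b)) (sym (cong₂ _+_ (δ-p∤ p∤a) (δ-p∤ p∤b)))

  ∑ₚ-δ-linear : ∀ {b} → ¬ P ∣ b → ∀ e → ∑ₚ (λ x → δ (b * x - e)) ≡ + 1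
  ∑ₚ-δ-linear {b} p∤b e = trans (∑ₚ-cong (λ x → δ-⇔ (to x) (from x))) (∑ₚ-δ-point (c * e))
    where
    c = proj₁ (inverse p∤b)
    scaled : ∀ x → b * (x - c * e) ≈ b * x - e
    scaled x = ≈-via (- e) (p∣a-b (proj₂ (inverse p∤b))) (ring b x c e)
      where ring : ∀ b x c e → b * (x - c * e) - (b * x - e) ≡ - e * (b * c - + 1)
            ring = solve-∀
    to : ∀ x → P ∣ b * x - e → P ∣ x - c * e
    to x = p∣*-cancelˡ p∤b ∘ p∣-resp-≈ (≈-sym (scaled x))
    from : ∀ x → P ∣ x - c * e → P ∣ b * x - e
    from x = p∣-resp-≈ (scaled x) ∘ ∣n⇒∣m*n b

  ∑ₚ-δ-square : ∀ z → ∑ₚ (λ y → δ (y * y - z)) ≡ + 1 + η p z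
  ∑ₚ-δ-square z with P ∣? z
  ... | yes p∣z = begin
    ∑ₚ (λ y → δ (y * y - z))   ≡⟨ ∑ₚ-cong (λ y → δ-⇔ (to y) (from y)) ⟩
    ∑ₚ (λ y → δ (y - + 0))     ≡⟨ ∑ₚ-δ-point (+ 0) ⟩
    + 1                        ≡⟨ cong (_+_ (+ 1)) (η-p∣ p∣z) ⟨
    + 1 + η p z                ∎
    where
    open ≡-Reasoning
    to : ∀ y → P ∣ y * y - z → P ∣ y - + 0
    to y p∣y²-z = subst (P ∣_) (sym (ℤP.+-identityʳ y))
      ([ id , id ] (p∣*⇒p∣⊎p∣ y y (subst (P ∣_) (ring y z) (∣m∣n⇒∣m+n p∣y²-z p∣z))))
      where ring : ∀ y z → y * y - z + z ≡ y * y
            ring = solve-∀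
    from : ∀ y → P ∣ y - + 0 → P ∣ y * y - z
    from y p∣y = ∣m∣n⇒∣m-n (∣m⇒∣m*n y (subst (P ∣_) (ℤP.+-identityʳ y) p∣y)) p∣z
  ... | no p∤z with η-dichotomy z p∤z
  ... | inj₂ (non-square , η≡-1) = begin
    ∑ₚ (λ y → δ (y * y - z))   ≡⟨ ∑ₚ-cong (λ y → δ-p∤ (λ p∣y²-z → non-square (y , mk≈ p∣y²-z))) ⟩
    ∑ₚ (λ _ → + 0)             ≡⟨ trans (∑ₚ-const (+ 0)) (ℤP.*-zeroʳ P) ⟩
    + 0                        ≡⟨ cong (_+_ (+ 1)) η≡-1 ⟨
    + 1 + η p z                ∎
    where open ≡-Reasoning
  ... | inj₁ ((s , s²≈z) , η≡1) = begin
    ∑ₚ (λ y → δ (y * y - z))                   ≡⟨ ∑ₚ-cong (λ y → trans (δ-resp-≈ (factor y)) (δ-* (roots-distinct y))) ⟩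
    ∑ₚ (λ y → δ (y - s) + δ (y - - s))         ≡⟨ ∑ₚ-+ (λ y → δ (y - s)) (λ y → δ (y - - s)) ⟩
    ∑ₚ (λ y → δ (y - s)) + ∑ₚ (λ y → δ (y - - s)) ≡⟨ cong₂ _+_ (∑ₚ-δ-point s) (∑ₚ-δ-point (- s)) ⟩
    + 1 + + 1                                  ≡⟨ cong (_+_ (+ 1)) η≡1 ⟨
    + 1 + η p z                                ∎
    where
    open ≡-Reasoning
    factor : ∀ y → y * y - z ≈ (y - s) * (y - - s)
    factor y = ≈-via (+ 1) (p∣a-b s²≈z) (ring y s z)
      where ring : ∀ y s z → y * y - z - (y - s) * (y - - s) ≡ + 1 * (s * s - z)
            ring = solve-∀
    p∤s : ¬ P ∣ s
    p∤s p∣s = p∤z (p∣-resp-≈ s²≈z (∣m⇒∣m*n s p∣s))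
    roots-distinct : ∀ y → ¬ (P ∣ y - s × P ∣ y - - s)
    roots-distinct y (p∣y-s , p∣y+s) =
      p∤* p∤2 p∤s (subst (P ∣_) (ring y s) (∣m∣n⇒∣m-n p∣y+s p∣y-s))
      where ring : ∀ y s → (y - - s) - (y - s) ≡ + 2 * s
            ring = solve-∀

  ∑ₚ-minus-1 : ∀ f → ∑ₚ (λ x → f x - + 1) ≡ ∑ₚ f - P
  ∑ₚ-minus-1 f = begin
    ∑ₚ (λ x → f x - + 1)        ≡⟨ ∑ₚ-+ f (λ _ → - + 1) ⟩
    ∑ₚ f + ∑ₚ (λ _ → - + 1)     ≡⟨ cong (_+_ (∑ₚ f)) (trans (∑ₚ-const (- + 1)) (ring P)) ⟩
    ∑ₚ f - P                    ∎
    where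
    open ≡-Reasoning
    ring : ∀ P → P * - + 1 ≡ - P
    ring = solve-∀

  η-square-mul : ∀ {s} z → ¬ P ∣ s → η p (s * s * z) ≡ η p z
  η-square-mul {s} z p∤s = by-divisibility (P ∣? z)
    where
    by-class : SquareClass z → SquareClass (s * s * z) → η p (s * s * z) ≡ η p z
    by-class (inj₁ (_ , η≡1))  (inj₁ (_ , η≡1′))  = trans η≡1′ (sym η≡1)
    by-class (inj₂ (_ , η≡-1)) (inj₂ (_ , η≡-1′)) = trans η≡-1′ (sym η≡-1)
    by-class (inj₁ ((t , t²≈z) , _)) (inj₂ (non-square , _)) =
      ⊥-elim (non-square (s * t , ≈-via (s * s) (p∣a-b t²≈z) (ring s t z)))
      where ring : ∀ s t z → s * t * (s * t) - s * s * z ≡ s * s * (t * t - z)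
            ring = solve-∀
    by-class (inj₂ (non-square , _)) (inj₁ ((u , u²≈s²z) , _)) = ⊥-elim (non-square (u * c , ≈-trans
        (≈-via (c * c) (p∣a-b u²≈s²z) (ring₁ u c s z))
        (≈-via ((s * c + + 1) * z) (p∣a-b (proj₂ (inverse p∤s))) (ring₂ u c s z))))
      where
      c = proj₁ (inverse p∤s)
      ring₁ : ∀ u c s z → u * c * (u * c) - c * c * (s * s * z) ≡ c * c * (u * u - s * s * z)
      ring₁ = solve-∀
      ring₂ : ∀ u c s z → c * c * (s * s * z) - z ≡ (s * c + + 1) * z * (s * c - + 1)
      ring₂ = solve-∀
    by-divisibility : Dec (P ∣ z) → η p (s * s * z) ≡ η p z
    by-divisibility (yes p∣z) = trans (η-p∣ (∣n⇒∣m*n (s * s) p∣z)) (sym (η-p∣ p∣z))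
    by-divisibility (no p∤z)  = by-class (η-dichotomy z p∤z) (η-dichotomy (s * s * z) (p∤* (p∤* p∤s p∤s) p∤z))

  η-by-roots : ∀ w → η p w ≡ ∑ₚ (λ y → δ (y * y - w)) - + 1
  η-by-roots w = trans (ring (η p w)) (cong (_- + 1) (sym (∑ₚ-δ-square w)))
    where ring : ∀ h → h ≡ + 1 + h - + 1
          ring = solve-∀

  ∑ₚ-η-linear : ∀ {b} → ¬ P ∣ b → ∀ e → ∑ₚ (λ x → η p (b * x + e)) ≡ + 0
  ∑ₚ-η-linear {b} p∤b e = begin
    ∑ₚ (λ x → η p (b * x + e))
      ≡⟨ ∑ₚ-cong (λ x → η-by-roots (b * x + e)) ⟩
    ∑ₚ (λ x → ∑ₚ (λ y → δ (y * y - (b * x + e))) - + 1)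
      ≡⟨ ∑ₚ-minus-1 _ ⟩
    ∑ₚ (λ x → ∑ₚ (λ y → δ (y * y - (b * x + e)))) - P
      ≡⟨ cong (_- P) (∑ₚ-comm (λ x y → δ (y * y - (b * x + e)))) ⟩
    ∑ₚ (λ y → ∑ₚ (λ x → δ (y * y - (b * x + e)))) - P
      ≡⟨ cong (_- P) (∑ₚ-cong (λ y → trans (∑ₚ-cong (λ x → trans (cong δ (ring y x b e)) (δ-neg _)))
                                             (∑ₚ-δ-linear p∤b (y * y - e)))) ⟩
    ∑ₚ (λ _ → + 1) - P
      ≡⟨ cong (_- P) (trans (∑ₚ-const (+ 1)) (ℤP.*-identityʳ P)) ⟩
    P - P
      ≡⟨ ℤP.+-inverseʳ P ⟩
    + 0 ∎
    where
    open ≡-Reasoning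
    ring : ∀ y x b e → y * y - (b * x + e) ≡ - (b * x - (y * y - e))
    ring = solve-∀

  η-square-*ˡ : ∀ {a} → IsSquare a → ¬ P ∣ a → ∀ b → η p (a * b) ≡ η p b
  η-square-*ˡ {a} (s , s²≈a) p∤a b =
    trans (η-resp-≈ (*-cong (≈-sym s²≈a) (≈-refl {b}))) (η-square-mul {s} b (p∤a ∘ p∣-resp-≈ s²≈a ∘ ∣m⇒∣m*n s))

  η≤1 : ∀ w → η p w ≤ + 1
  η≤1 w = by-divisibility (P ∣? w)
    where
    by-class : SquareClass w → η p w ≤ + 1
    by-class (inj₁ (_ , η≡1))  = subst (_≤ + 1) (sym η≡1) ℤP.≤-refl
    by-class (inj₂ (_ , η≡-1)) = subst (_≤ + 1) (sym η≡-1) ℤ.-≤+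
    by-divisibility : Dec (P ∣ w) → η p w ≤ + 1
    by-divisibility (yes p∣w) = subst (_≤ + 1) (sym (η-p∣ p∣w)) (ℤ.+≤+ z≤n)
    by-divisibility (no p∤w)  = by-class (η-dichotomy w p∤w)

  -- If a is a non-square, x ↦ η(a x) + η(x) is ≤ 0 everywhere and sums to 0, so it vanishes.
  η-nonsquare-* : ∀ {a b} → ¬ P ∣ a → ¬ IsSquare a → ¬ P ∣ b → ¬ IsSquare b → η p (a * b) ≡ + 1
  η-nonsquare-* {a} {b} p∤a a-nonsquare p∤b b-nonsquare =
    ring (η p (a * b)) (η p b) (F≡0 b) (η-nonresidue p∤b b-nonsquare)
    where
    F : ℤ → ℤ
    F x = η p (a * x) + η p x
    ∑F≡0 : ∑ₚ F ≡ + 0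
    ∑F≡0 = trans (∑ₚ-+ (λ x → η p (a * x)) (η p))
      (cong₂ _+_ (trans (∑ₚ-cong (λ x → cong (η p) (sym (ℤP.+-identityʳ (a * x))))) (∑ₚ-η-linear p∤a (+ 0)))
                 (trans (∑ₚ-cong (λ x → cong (η p) (ring₁ x))) (∑ₚ-η-linear p∤1 (+ 0))))
      where ring₁ : ∀ x → x ≡ + 1 * x + + 0
            ring₁ = solve-∀
    F≤0 : ∀ x → F x ≤ + 0
    F≤0 x = by-divisibility (P ∣? x)
      where
      by-class : ¬ P ∣ x → SquareClass x → F x ≤ + 0
      by-class p∤x (inj₁ (x-square , η≡1)) = subst (_≤ + 0) (sym (cong₂ _+_ ηax≡-1 η≡1)) ℤP.≤-refl
        where ηax≡-1 = trans (cong (η p) (ℤP.*-comm a x)) (trans (η-square-*ˡ x-square p∤x a) (η-nonresidue p∤a a-nonsquare))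
      by-class p∤x (inj₂ (_ , η≡-1)) =
        subst (λ h → η p (a * x) + h ≤ + 0) (sym η≡-1) (ℤP.+-monoˡ-≤ (- + 1) (η≤1 (a * x)))
      by-divisibility : Dec (P ∣ x) → F x ≤ + 0
      by-divisibility (yes p∣x) = subst (_≤ + 0) (sym (cong₂ _+_ (η-p∣ (∣n⇒∣m*n a p∣x)) (η-p∣ p∣x))) ℤP.≤-refl
      by-divisibility (no p∤x)  = by-class p∤x (η-dichotomy x p∤x)
    F≡0 : ∀ x → F x ≡ + 0
    F≡0 = ∑ₚ-nonpos-zero F (λ x≈y → cong₂ _+_ (η-resp-≈ (*-cong (≈-refl {a}) x≈y)) (η-resp-≈ x≈y)) F≤0 ∑F≡0
    ring : ∀ u v → u + v ≡ + 0 → v ≡ - + 1 → u ≡ + 1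
    ring u v u+v≡0 refl = trans (solve-u u) (cong (_+ + 1) u+v≡0)
      where solve-u : ∀ u → u ≡ u + - + 1 + + 1
            solve-u = solve-∀

  η-mul : ∀ a b → η p (a * b) ≡ η p a * η p b
  η-mul a b = by-divisibility (P ∣? a) (P ∣? b)
    where
    by-class : ¬ P ∣ a → ¬ P ∣ b → SquareClass a → SquareClass b → η p (a * b) ≡ η p a * η p b
    by-class p∤a p∤b (inj₁ (a-square , η≡1)) _ =
      trans (η-square-*ˡ a-square p∤a b) (sym (trans (cong (_* η p b) η≡1) (ℤP.*-identityˡ (η p b))))
    by-class p∤a p∤b (inj₂ _) (inj₁ (b-square , η≡1)) =
      trans (cong (η p) (ℤP.*-comm a b)) (trans (η-square-*ˡ b-square p∤b a) (sym (trans (cong (η p a *_) η≡1) (ℤP.*-identityʳ (η p a)))))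
    by-class p∤a p∤b (inj₂ (a-nonsquare , ηa≡-1)) (inj₂ (b-nonsquare , ηb≡-1)) =
      trans (η-nonsquare-* p∤a a-nonsquare p∤b b-nonsquare) (sym (cong₂ _*_ ηa≡-1 ηb≡-1))
    by-divisibility : Dec (P ∣ a) → Dec (P ∣ b) → η p (a * b) ≡ η p a * η p b
    by-divisibility (yes p∣a) _ =
      trans (η-p∣ (∣m⇒∣m*n b p∣a)) (sym (trans (cong (_* η p b) (η-p∣ p∣a)) (ℤP.*-zeroˡ (η p b))))
    by-divisibility (no _) (yes p∣b) =
      trans (η-p∣ (∣n⇒∣m*n a p∣b)) (sym (trans (cong (η p a *_) (η-p∣ p∣b)) (ℤP.*-zeroʳ (η p a))))
    by-divisibility (no p∤a) (no p∤b) = by-class p∤a p∤b (η-dichotomy a p∤a) (η-dichotomy b p∤b)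

  η-square : ∀ x → η p (x * x) ≡ + 1 - δ x
  η-square x = by-divisibility (P ∣? x)
    where
    by-divisibility : Dec (P ∣ x) → η p (x * x) ≡ + 1 - δ x
    by-divisibility (yes p∣x) = trans (η-p∣ (∣m⇒∣m*n x p∣x)) (sym (cong (_-_ (+ 1)) (δ-p∣ p∣x)))
    by-divisibility (no p∤x)  =
      trans (η-residue (p∤* p∤x p∤x) (x , ≈-refl)) (sym (cong (_-_ (+ 1)) (δ-p∤ p∤x)))

  ∑ₚ-1-δ : ∑ₚ (λ x → + 1 - δ x) ≡ P - + 1
  ∑ₚ-1-δ = begin
    ∑ₚ (λ x → + 1 - δ x)             ≡⟨ ∑ₚ-+ (λ _ → + 1) (λ x → - δ x) ⟩
    ∑ₚ (λ _ → + 1) + ∑ₚ (λ x → - δ x) ≡⟨ cong₂ _+_ (trans (∑ₚ-const (+ 1)) (ℤP.*-identityʳ P)) ∑-δ ⟩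
    P - + 1                          ∎
    where
    open ≡-Reasoning
    ∑-δ : ∑ₚ (λ x → - δ x) ≡ - + 1
    ∑-δ = trans (∑ₚ-cong (λ x → sym (ℤP.-1*i≡-i (δ x)))) (trans (∑ₚ-*ˡ (- + 1) δ) (cong (_*_ (- + 1)) ∑ₚ-δ))

  ∑ₚ-η-square : ∑ₚ (λ x → η p (x * x)) ≡ P - + 1
  ∑ₚ-η-square = trans (∑ₚ-cong η-square) ∑ₚ-1-δ

  ∑ₚ-η-square-shift : ∀ {d} → ¬ P ∣ d → ∑ₚ (λ x → η p (x * x - d)) ≡ - + 1
  ∑ₚ-η-square-shift {d} p∤d = begin
    ∑ₚ (λ x → η p (x * x - d))
      ≡⟨ ∑ₚ-cong (λ x → η-by-roots (x * x - d)) ⟩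
    ∑ₚ (λ x → ∑ₚ (G x) - + 1)
      ≡⟨ ∑ₚ-minus-1 (λ x → ∑ₚ (G x)) ⟩
    ∑ₚ (λ x → ∑ₚ (G x)) - P
      ≡⟨ cong (_- P) (∑ₚ-cong (λ x → sym (∑ₚ-shift (G x) (λ a≈b → δ-resp-≈ (+-cong (*-cong a≈b a≈b) ≈-refl)) (- x)))) ⟩
    ∑ₚ (λ x → ∑ₚ (λ s → G x (s - x))) - P
      ≡⟨ cong (_- P) (∑ₚ-comm (λ x s → G x (s - x))) ⟩
    ∑ₚ (λ s → ∑ₚ (λ x → G x (s - x))) - P
      ≡⟨ cong (_- P) (trans (∑ₚ-cong inner) ∑ₚ-1-δ) ⟩
    P - + 1 - P
      ≡⟨ ring P ⟩
    - + 1 ∎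
    where
    open ≡-Reasoning
    G : ℤ → ℤ → ℤ
    G x y = δ (y * y - (x * x - d))
    linear : ∀ s x → G x (s - x) ≡ δ (- (+ 2 * s) * x - - (s * s + d))
    linear s x = cong δ (ring′ s x d)
      where ring′ : ∀ s x d → (s - x) * (s - x) - (x * x - d) ≡ - (+ 2 * s) * x - - (s * s + d)
            ring′ = solve-∀
    inner : ∀ s → ∑ₚ (λ x → G x (s - x)) ≡ + 1 - δ s
    inner s = by-divisibility (P ∣? s)
      where
      by-divisibility : Dec (P ∣ s) → ∑ₚ (λ x → G x (s - x)) ≡ + 1 - δ s
      by-divisibility (no p∤s) =
        trans (∑ₚ-cong (linear s)) (trans (∑ₚ-δ-linear (p∤* p∤2 p∤s ∘ p∣-neg⁻) (- (s * s + d)))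
                                          (sym (cong (_-_ (+ 1)) (δ-p∤ p∤s))))
      by-divisibility (yes p∣s) =
        trans (∑ₚ-cong (λ x → δ-p∤ (p∤d ∘ p∣d x)))
              (trans (trans (∑ₚ-const (+ 0)) (ℤP.*-zeroʳ P)) (sym (cong (_-_ (+ 1)) (δ-p∣ p∣s))))
        where
        p∣d : ∀ x → P ∣ (s - x) * (s - x) - (x * x - d) → P ∣ d
        p∣d x p∣G = subst (P ∣_) (ring′ s x d) (∣m∣n⇒∣m-n p∣G (∣m⇒∣m*n (s - + 2 * x) p∣s))
          where ring′ : ∀ s x d → (s - x) * (s - x) - (x * x - d) - s * (s - + 2 * x) ≡ d
                ring′ = solve-∀
    ring : ∀ P → P - + 1 - P ≡ - + 1
    ring = solve-∀

  ν : ℤ → ℤ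
  ν e = P * δ e - + 1

  ν-resp-≈ : Respects≈ ν
  ν-resp-≈ a≈b = cong (λ d → P * d - + 1) (δ-resp-≈ a≈b)

  ν-⇔ : ∀ {a b} → (P ∣ a → P ∣ b) → (P ∣ b → P ∣ a) → ν a ≡ ν b
  ν-⇔ to from = cong (λ d → P * d - + 1) (δ-⇔ to from)

  ν-neg : ∀ a → ν (- a) ≡ ν a
  ν-neg a = cong (λ d → P * d - + 1) (δ-neg a)

  ν-p∣ : ∀ {e} → P ∣ e → ν e ≡ P - + 1
  ν-p∣ p∣e = trans (cong (λ d → P * d - + 1) (δ-p∣ p∣e)) (cong (_- + 1) (ℤP.*-identityʳ P))

  ν-p∤ : ∀ {e} → ¬ P ∣ e → ν e ≡ - + 1
  ν-p∤ p∤e = trans (cong (λ d → P * d - + 1) (δ-p∤ p∤e)) (cong (_- + 1) (ℤP.*-zeroʳ P))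

  p∤inverse : ∀ a {c} → a * c ≈ + 1 → ¬ P ∣ c
  p∤inverse a ac≈1 p∣c = p∤1 (p∣-resp-≈ ac≈1 (∣n⇒∣m*n a p∣c))

  δ-unit-* : ∀ {a} → ¬ P ∣ a → ∀ t → δ (a * t) ≡ δ t
  δ-unit-* {a} p∤a t = δ-⇔ (p∣*-cancelˡ p∤a) (∣n⇒∣m*n a)

  complete-square : ∀ a c → a * c ≈ + 1 → ∀ x e → a * (x * x) + e ≈ a * (x * x - - (c * e))
  complete-square a c (mk≈ p∣ac-1) x e = ≈-via (- e) p∣ac-1 (ring a c x e)
    where ring : ∀ a c x e → a * (x * x) + e - a * (x * x - - (c * e)) ≡ - e * (a * c - + 1)
          ring = solve-∀

  ∑ₚ-η-quadratic : ∀ {a} → ¬ P ∣ a → ∀ e → ∑ₚ (λ x → η p (a * (x * x) + e)) ≡ η p a * ν e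
  ∑ₚ-η-quadratic {a} p∤a e = begin
    ∑ₚ (λ x → η p (a * (x * x) + e))
      ≡⟨ ∑ₚ-cong (λ x → trans (η-resp-≈ (complete-square a c ac≈1 x e)) (η-mul a (x * x - d))) ⟩
    ∑ₚ (λ x → η p a * η p (x * x - d))
      ≡⟨ ∑ₚ-*ˡ (η p a) (λ x → η p (x * x - d)) ⟩
    η p a * ∑ₚ (λ x → η p (x * x - d))
      ≡⟨ cong (η p a *_) (by-divisibility (P ∣? e)) ⟩
    η p a * ν e ∎
    where
    open ≡-Reasoning
    c = proj₁ (inverse p∤a)
    ac≈1 = proj₂ (inverse p∤a)
    d = - (c * e)
    by-divisibility : Dec (P ∣ e) → ∑ₚ (λ x → η p (x * x - d)) ≡ ν e
    by-divisibility (yes p∣e) =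
      trans (∑ₚ-cong (λ x → η-resp-≈ {x * x - d} (≈-via (+ 1) p∣d (ring x d))))
            (trans ∑ₚ-η-square (sym (ν-p∣ p∣e)))
      where
      p∣d : P ∣ - d
      p∣d = subst (P ∣_) (sym (ℤP.neg-involutive (c * e))) (∣n⇒∣m*n c p∣e)
      ring : ∀ x d → x * x - d - x * x ≡ + 1 * - d
      ring = solve-∀
    by-divisibility (no p∤e) = trans (∑ₚ-η-square-shift p∤d) (sym (ν-p∤ p∤e))
      where
      p∤d : ¬ P ∣ d
      p∤d p∣d = p∤* (p∤inverse a ac≈1) p∤e (subst (P ∣_) (ℤP.neg-involutive (c * e)) (∣m⇒∣-m p∣d))

  ∑ₚ-ν-quadratic : ∀ {a} → ¬ P ∣ a → ∀ e → ∑ₚ (λ x → ν (a * (x * x) + e)) ≡ P * η p (- (a * e))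
  ∑ₚ-ν-quadratic {a} p∤a e = begin
    ∑ₚ (λ x → ν (a * (x * x) + e))
      ≡⟨ ∑ₚ-minus-1 (λ x → P * δ (a * (x * x) + e)) ⟩
    ∑ₚ (λ x → P * δ (a * (x * x) + e)) - P
      ≡⟨ cong (_- P) (∑ₚ-*ˡ P (λ x → δ (a * (x * x) + e))) ⟩
    P * ∑ₚ (λ x → δ (a * (x * x) + e)) - P
      ≡⟨ cong (λ t → P * t - P) (∑ₚ-cong (λ x → trans (δ-resp-≈ (complete-square a c ac≈1 x e)) (δ-unit-* p∤a _))) ⟩
    P * ∑ₚ (λ x → δ (x * x - d)) - P
      ≡⟨ cong (λ t → P * t - P) (∑ₚ-δ-square d) ⟩
    P * (+ 1 + η p d) - P
      ≡⟨ ring P (η p d) ⟩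
    P * η p d
      ≡⟨ cong (P *_) (trans (sym (η-square-mul {a} d p∤a)) (η-resp-≈ {a * a * d} (≈-via (- (a * e)) (p∣a-b ac≈1) (ring′ a c e)))) ⟩
    P * η p (- (a * e)) ∎
    where
    open ≡-Reasoning
    c = proj₁ (inverse p∤a)
    ac≈1 = proj₂ (inverse p∤a)
    d = - (c * e)
    ring : ∀ P h → P * (+ 1 + h) - P ≡ P * h
    ring = solve-∀
    ring′ : ∀ a c e → a * a * - (c * e) - - (a * e) ≡ - (a * e) * (a * c - + 1)
    ring′ = solve-∀

  ∑ₚ-ν-linear : ∀ {b} → ¬ P ∣ b → ∀ e → ∑ₚ (λ x → ν (b * x + e)) ≡ + 0
  ∑ₚ-ν-linear {b} p∤b e = begin
    ∑ₚ (λ x → ν (b * x + e))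
      ≡⟨ ∑ₚ-minus-1 (λ x → P * δ (b * x + e)) ⟩
    ∑ₚ (λ x → P * δ (b * x + e)) - P
      ≡⟨ cong (_- P) (∑ₚ-*ˡ P (λ x → δ (b * x + e))) ⟩
    P * ∑ₚ (λ x → δ (b * x + e)) - P
      ≡⟨ cong (λ t → P * t - P) (trans (∑ₚ-cong (λ x → cong δ (ring b x e))) (∑ₚ-δ-linear p∤b (- e))) ⟩
    P * + 1 - P
      ≡⟨ ring′ P ⟩
    + 0 ∎
    where
    open ≡-Reasoning
    ring : ∀ b x e → b * x + e ≡ b * x - - e
    ring = solve-∀
    ring′ : ∀ P → P * + 1 - P ≡ + 0
    ring′ = solve-∀

  ∑ₚ-p∣-linear : ∀ f → Respects≈ f → ∀ {b} → P ∣ b → ∀ e → ∑ₚ (λ x → f (b * x + e)) ≡ P * f e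
  ∑ₚ-p∣-linear f resp {b} p∣b e =
    trans (∑ₚ-cong (λ x → resp (≈-via x p∣b (ring b x e)))) (∑ₚ-const (f e))
    where ring : ∀ b x e → b * x + e - e ≡ x * b
          ring = solve-∀

  ∑ₚ-δ-sift : ∀ h → Respects≈ h → ∀ u → ∑ₚ (λ x → δ (u - x) * h x) ≡ h u
  ∑ₚ-δ-sift h resp u = begin
    ∑ₚ (λ x → δ (u - x) * h x)      ≡⟨ ∑ₚ-cong (λ x → pointwise x (P ∣? (x - u))) ⟩
    ∑ₚ (λ x → h u * δ (x - u))      ≡⟨ ∑ₚ-*ˡ (h u) (λ x → δ (x - u)) ⟩
    h u * ∑ₚ (λ x → δ (x - u))      ≡⟨ cong (h u *_) (∑ₚ-δ-point u) ⟩
    h u * + 1                       ≡⟨ ℤP.*-identityʳ (h u) ⟩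
    h u                             ∎
    where
    open ≡-Reasoning
    swap : ∀ x → δ (u - x) ≡ δ (x - u)
    swap x = trans (cong δ (ring u x)) (δ-neg (x - u))
      where ring : ∀ u x → u - x ≡ - (x - u)
            ring = solve-∀
    pointwise : ∀ x → Dec (P ∣ x - u) → δ (u - x) * h x ≡ h u * δ (x - u)
    pointwise x (yes p∣x-u) rewrite swap x | δ-p∣ p∣x-u =
      trans (ℤP.*-identityˡ (h x)) (trans (resp (mk≈ p∣x-u)) (sym (ℤP.*-identityʳ (h u))))
    pointwise x (no p∤x-u) rewrite swap x | δ-p∤ p∤x-u = sym (ℤP.*-zeroʳ (h u))

  hits : ℤ → ℤ → ∀ {k} → Vec ℕ k → Bool
  hits u w v = does (P ∣? (+ e₁ v - u)) ∧ does (P ∣? (+ sumSq v - w))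

  hits-∷ : ∀ u w x {k} (v : Vec ℕ k) → hits u w (x ∷ v) ≡ hits (u - + x) (w - + x * + x) v
  hits-∷ u w x v = cong₂ _∧_ (cong (does ∘ (P ∣?_)) e₁-shift) (cong (does ∘ (P ∣?_)) sumSq-shift)
    where
    ring : ∀ a b c → a + b - c ≡ b - (c - a)
    ring = solve-∀
    e₁-shift : + (x ℕ.+ e₁ v) - u ≡ + e₁ v - (u - + x)
    e₁-shift = trans (cong (_- u) (ℤP.pos-+ x (e₁ v))) (ring (+ x) (+ e₁ v) u)
    sumSq-shift : + (x ℕ.* x ℕ.+ sumSq v) - w ≡ + sumSq v - (w - + x * + x)
    sumSq-shift = trans (cong (_- w) (trans (ℤP.pos-+ (x ℕ.* x) (sumSq v)) (cong (_+ + sumSq v) (ℤP.pos-* x x))))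
                        (ring (+ x * + x) (+ sumSq v) w)

  reps : ℕ → ℤ → ℤ → ℤ
  reps k u w = + count p k (hits u w)

  reps-zero : ∀ u w → reps 0 u w ≡ δ (+ 0 - u) * δ (+ 0 - w)
  reps-zero u w = begin
    reps 0 u w                         ≡⟨ count-zero p (hits u w) ⟩
    indicator (b₁ ∧ b₂)                ≡⟨ indicator-∧ b₁ b₂ ⟩
    indicator b₁ * indicator b₂        ≡⟨ cong₂ _*_ (δ-does (+ 0 - u)) (δ-does (+ 0 - w)) ⟨
    δ (+ 0 - u) * δ (+ 0 - w)          ∎
    where
    open ≡-Reasoning
    b₁ b₂ : Bool
    b₁ = does (P ∣? (+ 0 - u))
    b₂ = does (P ∣? (+ 0 - w))
    indicator : Bool → ℤ
    indicator b = if b then + 1 else + 0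
    indicator-∧ : ∀ b c → indicator (b ∧ c) ≡ indicator b * indicator c
    indicator-∧ true  true  = refl
    indicator-∧ true  false = refl
    indicator-∧ false true  = refl
    indicator-∧ false false = refl

  reps-suc : ∀ k u w → reps (suc k) u w ≡ ∑ₚ (λ x → reps k (u - x) (w - x * x))
  reps-suc k u w = trans (count-suc p k (hits u w)) (trans
    (sum-cong-≗ {p} (λ x → cong +_ (count-cong p k (hits-∷ u w (toℕ x)))))
    (∑ₚ-sum (λ x → reps k (u - x) (w - x * x))))

  reps-step : ∀ k e (E : ℤ → ℤ → ℤ) → (∀ u w → P * reps k u w ≡ P ^ e + E u w) →
           ∀ u w → P * reps (suc k) u w ≡ P ^ suc e + ∑ₚ (λ x → E (u - x) (w - x * x))
  reps-step k e E closed u w = begin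
    P * reps (suc k) u w
      ≡⟨ cong (P *_) (reps-suc k u w) ⟩
    P * ∑ₚ (λ x → reps k (u - x) (w - x * x))
      ≡⟨ ∑ₚ-*ˡ P (λ x → reps k (u - x) (w - x * x)) ⟨
    ∑ₚ (λ x → P * reps k (u - x) (w - x * x))
      ≡⟨ ∑ₚ-cong (λ x → closed (u - x) (w - x * x)) ⟩
    ∑ₚ (λ x → P ^ e + E (u - x) (w - x * x))
      ≡⟨ ∑ₚ-+ (λ _ → P ^ e) (λ x → E (u - x) (w - x * x)) ⟩
    ∑ₚ (λ _ → P ^ e) + ∑ₚ (λ x → E (u - x) (w - x * x))
      ≡⟨ cong (_+ ∑ₚ (λ x → E (u - x) (w - x * x))) (∑ₚ-const (P ^ e)) ⟩
    P ^ suc e + ∑ₚ (λ x → E (u - x) (w - x * x)) ∎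
    where open ≡-Reasoning

  quadratic-resp : ∀ f → Respects≈ f → ∀ a e → Respects≈ (λ y → f (a * (y * y) + e))
  quadratic-resp f resp a e y≈y′ = resp (+-cong (*-cong (≈-refl {a}) (*-cong y≈y′ y≈y′)) (≈-refl {e}))

  -- K·w − u² is K·Σaᵢ² − (Σaᵢ)² = Σ_{i<j} (aᵢ − aⱼ)² for a tuple of length K.
  disc : ℤ → ℤ → ℤ → ℤ
  disc K u w = K * w - u * u

  disc-shift-square : ∀ K u w j x → (K + + 1) * j ≈ + 1 →
    disc K (u - x) (w - x * x) ≈ - (K + + 1) * ((x - u * j) * (x - u * j)) + (disc K u w + u * u * j)
  disc-shift-square K u w j x (mk≈ p∣t) = ≈-via (u * u * j - + 2 * u * x) p∣t (ring K u w j x)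
    where ring : ∀ K u w j x → K * (w - x * x) - (u - x) * (u - x) - (- (K + + 1) * ((x - u * j) * (x - u * j)) + (K * w - u * u + u * u * j))
                             ≡ (u * u * j - + 2 * u * x) * ((K + + 1) * j - + 1)
          ring = solve-∀

  disc-shift-constant : ∀ K u w j → (K + + 1) * j ≈ + 1 → (K + + 1) * (disc K u w + u * u * j) ≈ K * disc (K + + 1) u w
  disc-shift-constant K u w j (mk≈ p∣t) = ≈-via (u * u) p∣t (ring K u w j)
    where ring : ∀ K u w j → (K + + 1) * (K * w - u * u + u * u * j) - K * ((K + + 1) * w - u * u) ≡ u * u * ((K + + 1) * j - + 1)
          ring = solve-∀

  disc-shift-p∣K+1 : ∀ K → P ∣ K + + 1 → ∀ u w x → disc K (u - x) (w - x * x) ≈ + 2 * u * x + disc K u w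
  disc-shift-p∣K+1 K p∣K+1 u w x = ≈-via (- (x * x)) p∣K+1 (ring K u w x)
    where ring : ∀ K u w x → K * (w - x * x) - (u - x) * (u - x) - (+ 2 * u * x + (K * w - u * u)) ≡ - (x * x) * (K + + 1)
          ring = solve-∀

  disc-p∣K+1 : ∀ K {u} → P ∣ K + + 1 → P ∣ u → ∀ w → disc K u w ≈ - w
  disc-p∣K+1 K {u} p∣K+1 p∣u w = mk≈ (subst (P ∣_) (ring K u w) (∣m∣n⇒∣m-n (∣m⇒∣m*n w p∣K+1) (∣m⇒∣m*n u p∣u)))
    where ring : ∀ K u w → (K + + 1) * w - u * u ≡ K * w - u * u - - w
          ring = solve-∀

  disc-p∣K : ∀ K → P ∣ K → ∀ u w → disc (K + + 1) u w ≈ w - u * u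
  disc-p∣K K p∣K u w = ≈-via w p∣K (ring K u w)
    where ring : ∀ K u w → (K + + 1) * w - u * u - (w - u * u) ≡ w * K
          ring = solve-∀

  ∑ₚ-ν-disc : ∀ K → ¬ P ∣ K + + 1 → ∀ u w →
    ∑ₚ (λ x → ν (disc K (u - x) (w - x * x))) ≡ P * η p (K * disc (K + + 1) u w)
  ∑ₚ-ν-disc K p∤K+1 u w = begin
    ∑ₚ (λ x → ν (disc K (u - x) (w - x * x)))
      ≡⟨ ∑ₚ-cong (λ x → ν-resp-≈ (disc-shift-square K u w j x [K+1]j≈1)) ⟩
    ∑ₚ (λ x → F (x - u * j))
      ≡⟨ ∑ₚ-shift F F-resp (- (u * j)) ⟩
    ∑ₚ F
      ≡⟨ ∑ₚ-ν-quadratic (p∤K+1 ∘ p∣-neg⁻) e ⟩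
    P * η p (- (- (K + + 1) * e))
      ≡⟨ cong (P *_) (η-resp-≈ (≈-trans (≈-reflexive (ring K e)) (disc-shift-constant K u w j [K+1]j≈1))) ⟩
    P * η p (K * disc (K + + 1) u w) ∎
    where
    open ≡-Reasoning
    j = proj₁ (inverse p∤K+1)
    [K+1]j≈1 = proj₂ (inverse p∤K+1)
    e = disc K u w + u * u * j
    F : ℤ → ℤ
    F y = ν (- (K + + 1) * (y * y) + e)
    F-resp : Respects≈ F
    F-resp = quadratic-resp ν ν-resp-≈ (- (K + + 1)) e
    ring : ∀ K e → - (- (K + + 1) * e) ≡ (K + + 1) * e
    ring = solve-∀

  ∑ₚ-η-disc : ∀ K {s} → ¬ P ∣ s → ¬ P ∣ K → ¬ P ∣ K + + 1 → ∀ u w →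
    ∑ₚ (λ x → η p (s * disc K (u - x) (w - x * x))) ≡ η p (- s * (K + + 1)) * ν (disc (K + + 1) u w)
  ∑ₚ-η-disc K {s} p∤s p∤K p∤K+1 u w = begin
    ∑ₚ (λ x → η p (s * disc K (u - x) (w - x * x)))
      ≡⟨ ∑ₚ-cong (λ x → η-resp-≈ {s * disc K (u - x) (w - x * x)}
           (≈-trans (*-cong (≈-refl {s}) (disc-shift-square K u w j x [K+1]j≈1)) (≈-reflexive (ring s K _ e)))) ⟩
    ∑ₚ (λ x → F (x - u * j))
      ≡⟨ ∑ₚ-shift F F-resp (- (u * j)) ⟩
    ∑ₚ F
      ≡⟨ ∑ₚ-η-quadratic (p∤* p∤s (p∤K+1 ∘ p∣-neg⁻)) (s * e) ⟩
    η p (s * - (K + + 1)) * ν (s * e)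
      ≡⟨ cong₂ _*_ (cong (η p) (ring′ s K)) (ν-⇔ to from) ⟩
    η p (- s * (K + + 1)) * ν (disc (K + + 1) u w) ∎
    where
    open ≡-Reasoning
    j = proj₁ (inverse p∤K+1)
    [K+1]j≈1 = proj₂ (inverse p∤K+1)
    e = disc K u w + u * u * j
    F : ℤ → ℤ
    F y = η p (s * - (K + + 1) * (y * y) + s * e)
    F-resp : Respects≈ F
    F-resp = quadratic-resp (η p) η-resp-≈ (s * - (K + + 1)) (s * e)
    ring : ∀ s K y e → s * (- (K + + 1) * y + e) ≡ s * - (K + + 1) * y + s * e
    ring = solve-∀
    ring′ : ∀ s K → s * - (K + + 1) ≡ - s * (K + + 1)
    ring′ = solve-∀
    completed = disc-shift-constant K u w j [K+1]j≈1
    to : P ∣ s * e → P ∣ disc (K + + 1) u w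
    to = p∣*-cancelˡ p∤K ∘ p∣-resp-≈ completed ∘ ∣n⇒∣m*n (K + + 1) ∘ p∣*-cancelˡ p∤s
    from : P ∣ disc (K + + 1) u w → P ∣ s * e
    from = ∣n⇒∣m*n s ∘ p∣*-cancelˡ p∤K+1 ∘ p∣-resp-≈ (≈-sym completed) ∘ ∣n⇒∣m*n K

  ∑ₚ-ν-disc-p∣K+1 : ∀ K → P ∣ K + + 1 → ∀ u w →
    ∑ₚ (λ x → ν (disc K (u - x) (w - x * x))) ≡ P * (δ u * ν w)
  ∑ₚ-ν-disc-p∣K+1 K p∣K+1 u w =
    trans (∑ₚ-cong (λ x → ν-resp-≈ (disc-shift-p∣K+1 K p∣K+1 u w x))) (by-divisibility (P ∣? u))
    where
    by-divisibility : Dec (P ∣ u) → ∑ₚ (λ x → ν (+ 2 * u * x + disc K u w)) ≡ P * (δ u * ν w)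
    by-divisibility (no p∤u) =
      trans (∑ₚ-ν-linear (p∤* p∤2 p∤u) (disc K u w))
            (sym (trans (cong (λ d → P * (d * ν w)) (δ-p∤ p∤u)) (ℤP.*-zeroʳ P)))
    by-divisibility (yes p∣u) =
      trans (∑ₚ-p∣-linear ν ν-resp-≈ (∣n⇒∣m*n (+ 2) p∣u) (disc K u w))
            (cong (P *_) (trans (trans (ν-resp-≈ (disc-p∣K+1 K p∣K+1 p∣u w)) (ν-neg w))
                                (sym (trans (cong (_* ν w) (δ-p∣ p∣u)) (ℤP.*-identityˡ (ν w))))))

  ∑ₚ-η-disc-p∣K+1 : ∀ K {s} → ¬ P ∣ s → P ∣ K + + 1 → ∀ u w →
    ∑ₚ (λ x → η p (s * disc K (u - x) (w - x * x))) ≡ P * (δ u * η p (- s * w))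
  ∑ₚ-η-disc-p∣K+1 K {s} p∤s p∣K+1 u w =
    trans (∑ₚ-cong (λ x → η-resp-≈ {s * disc K (u - x) (w - x * x)} (linear x))) (by-divisibility (P ∣? u))
    where
    linear : ∀ x → s * disc K (u - x) (w - x * x) ≈ s * (+ 2 * u) * x + s * disc K u w
    linear x = ≈-trans (*-cong (≈-refl {s}) (disc-shift-p∣K+1 K p∣K+1 u w x)) (≈-reflexive (ring s u x (disc K u w)))
      where ring : ∀ s u x d → s * (+ 2 * u * x + d) ≡ s * (+ 2 * u) * x + s * d
            ring = solve-∀
    by-divisibility : Dec (P ∣ u) → ∑ₚ (λ x → η p (s * (+ 2 * u) * x + s * disc K u w)) ≡ P * (δ u * η p (- s * w))
    by-divisibility (no p∤u) =
      trans (∑ₚ-η-linear (p∤* p∤s (p∤* p∤2 p∤u)) (s * disc K u w))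
            (sym (trans (cong (λ d → P * (d * η p (- s * w))) (δ-p∤ p∤u)) (ℤP.*-zeroʳ P)))
    by-divisibility (yes p∣u) =
      trans (∑ₚ-p∣-linear (η p) η-resp-≈ (∣n⇒∣m*n s (∣n⇒∣m*n (+ 2) p∣u)) (s * disc K u w))
            (cong (P *_) (trans (η-resp-≈ (≈-trans (*-cong (≈-refl {s}) (disc-p∣K+1 K p∣K+1 p∣u w)) (≈-reflexive (ring s w))))
                                (sym (trans (cong (_* η p (- s * w)) (δ-p∣ p∣u)) (ℤP.*-identityˡ _)))))
      where ring : ∀ s w → s * - w ≡ - s * w
            ring = solve-∀

  σ : ℕ → ℤ
  σ m = (- (+ 1)) ^ m

  σ-square : ∀ m → σ m * σ m ≡ + 1
  σ-square zero    = refl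
  σ-square (suc m) = trans (ring (σ m)) (σ-square m)
    where ring : ∀ s → - + 1 * s * (- + 1 * s) ≡ s * s
          ring = solve-∀

  p∤σ : ∀ m → ¬ P ∣ σ m
  p∤σ m p∣σ = p∤1 (subst (P ∣_) (σ-square m) (∣m⇒∣m*n (σ m) p∣σ))

  p∣K⇒p∤K+1 : ∀ {K} → P ∣ K → ¬ P ∣ K + + 1
  p∣K⇒p∤K+1 {K} p∣K p∣K+1 = p∤1 (subst (P ∣_) (ring K) (∣m∣n⇒∣m-n p∣K+1 p∣K))
    where ring : ∀ K → K + + 1 - K ≡ + 1
          ring = solve-∀

  -- The error term E in p · reps k u w = p^(k−1) + E is Eₒ m (+ k) for k = 2m+1 and
  -- Eₑ m (+ k) for k = 2m+2; K is kept as a variable so that the step from k to k+1 is uniform.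
  Eₒ : ℕ → ℤ → ℤ → ℤ → ℤ
  Eₒ m K u w = if does (P ∣? K) then P ^ suc m * δ u * η p (σ m * w)
               else P ^ m * η p (σ m * K) * ν (disc K u w)

  Eₑ : ℕ → ℤ → ℤ → ℤ → ℤ
  Eₑ m K u w = if does (P ∣? K) then P ^ suc m * δ u * ν w * η p (- σ m)
               else P ^ suc m * η p (σ m * disc K u w)

  Eₒ-p∣ : ∀ m {K} → P ∣ K → ∀ u w → Eₒ m K u w ≡ P ^ suc m * δ u * η p (σ m * w)
  Eₒ-p∣ m {K} p∣K u w =
    cong (if_then P ^ suc m * δ u * η p (σ m * w) else P ^ m * η p (σ m * K) * ν (disc K u w)) (dec-true (P ∣? K) p∣K)

  Eₒ-p∤ : ∀ m {K} → ¬ P ∣ K → ∀ u w → Eₒ m K u w ≡ P ^ m * η p (σ m * K) * ν (disc K u w)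
  Eₒ-p∤ m {K} p∤K u w =
    cong (if_then P ^ suc m * δ u * η p (σ m * w) else P ^ m * η p (σ m * K) * ν (disc K u w)) (dec-false (P ∣? K) p∤K)

  Eₑ-p∣ : ∀ m {K} → P ∣ K → ∀ u w → Eₑ m K u w ≡ P ^ suc m * δ u * ν w * η p (- σ m)
  Eₑ-p∣ m {K} p∣K u w =
    cong (if_then P ^ suc m * δ u * ν w * η p (- σ m) else P ^ suc m * η p (σ m * disc K u w)) (dec-true (P ∣? K) p∣K)

  Eₑ-p∤ : ∀ m {K} → ¬ P ∣ K → ∀ u w → Eₑ m K u w ≡ P ^ suc m * η p (σ m * disc K u w)
  Eₑ-p∤ m {K} p∤K u w =
    cong (if_then P ^ suc m * δ u * ν w * η p (- σ m) else P ^ suc m * η p (σ m * disc K u w)) (dec-false (P ∣? K) p∤K)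

  ∑Eₒ-p∣K : ∀ m K → P ∣ K → ∀ u w → ∑ₚ (λ x → Eₒ m K (u - x) (w - x * x)) ≡ Eₑ m (K + + 1) u w
  ∑Eₒ-p∣K m K p∣K u w = begin
    ∑ₚ (λ x → Eₒ m K (u - x) (w - x * x))
      ≡⟨ ∑ₚ-cong (λ x → trans (Eₒ-p∣ m p∣K (u - x) (w - x * x)) (ℤP.*-assoc (P ^ suc m) (δ (u - x)) _)) ⟩
    ∑ₚ (λ x → P ^ suc m * (δ (u - x) * η p (σ m * (w - x * x))))
      ≡⟨ ∑ₚ-*ˡ (P ^ suc m) (λ x → δ (u - x) * η p (σ m * (w - x * x))) ⟩
    P ^ suc m * ∑ₚ (λ x → δ (u - x) * η p (σ m * (w - x * x)))
      ≡⟨ cong (P ^ suc m *_) (∑ₚ-δ-sift (λ x → η p (σ m * (w - x * x))) resp u) ⟩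
    P ^ suc m * η p (σ m * (w - u * u))
      ≡⟨ cong (P ^ suc m *_) (η-resp-≈ (*-cong (≈-refl {σ m}) (≈-sym (disc-p∣K K p∣K u w)))) ⟩
    P ^ suc m * η p (σ m * disc (K + + 1) u w)
      ≡⟨ Eₑ-p∤ m (p∣K⇒p∤K+1 p∣K) u w ⟨
    Eₑ m (K + + 1) u w ∎
    where
    open ≡-Reasoning
    resp : Respects≈ (λ x → η p (σ m * (w - x * x)))
    resp {x} {y} x≈y = η-resp-≈ {σ m * (w - x * x)} {σ m * (w - y * y)}
                         (*-cong (≈-refl {σ m}) (+-cong (≈-refl {w}) (-‿cong (*-cong x≈y x≈y))))

  ∑Eₒ-p∣K+1 : ∀ m K → P ∣ K + + 1 → ∀ u w → ∑ₚ (λ x → Eₒ m K (u - x) (w - x * x)) ≡ Eₑ m (K + + 1) u w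
  ∑Eₒ-p∣K+1 m K p∣K+1 u w = begin
    ∑ₚ (λ x → Eₒ m K (u - x) (w - x * x))
      ≡⟨ ∑ₚ-cong (λ x → Eₒ-p∤ m p∤K (u - x) (w - x * x)) ⟩
    ∑ₚ (λ x → c * ν (disc K (u - x) (w - x * x)))
      ≡⟨ ∑ₚ-*ˡ c (λ x → ν (disc K (u - x) (w - x * x))) ⟩
    c * ∑ₚ (λ x → ν (disc K (u - x) (w - x * x)))
      ≡⟨ cong (c *_) (∑ₚ-ν-disc-p∣K+1 K p∣K+1 u w) ⟩
    P ^ m * η p (σ m * K) * (P * (δ u * ν w))
      ≡⟨ cong (λ h → P ^ m * h * (P * (δ u * ν w))) (η-resp-≈ {σ m * K} (≈-via (σ m) p∣K+1 (ring₁ (σ m) K))) ⟩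
    P ^ m * η p (- σ m) * (P * (δ u * ν w))
      ≡⟨ ring₂ (P ^ m) P (η p (- σ m)) (δ u) (ν w) ⟩
    P ^ suc m * δ u * ν w * η p (- σ m)
      ≡⟨ Eₑ-p∣ m p∣K+1 u w ⟨
    Eₑ m (K + + 1) u w ∎
    where
    open ≡-Reasoning
    p∤K : ¬ P ∣ K
    p∤K p∣K = p∣K⇒p∤K+1 p∣K p∣K+1
    c = P ^ m * η p (σ m * K)
    ring₁ : ∀ s K → s * K - - s ≡ s * (K + + 1)
    ring₁ = solve-∀
    ring₂ : ∀ a P h d n → a * h * (P * (d * n)) ≡ P * a * d * n * h
    ring₂ = solve-∀

  ∑Eₒ-units : ∀ m K → ¬ P ∣ K → ¬ P ∣ K + + 1 → ∀ u w →
    ∑ₚ (λ x → Eₒ m K (u - x) (w - x * x)) ≡ Eₑ m (K + + 1) u w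
  ∑Eₒ-units m K p∤K p∤K+1 u w = begin
    ∑ₚ (λ x → Eₒ m K (u - x) (w - x * x))
      ≡⟨ ∑ₚ-cong (λ x → Eₒ-p∤ m p∤K (u - x) (w - x * x)) ⟩
    ∑ₚ (λ x → c * ν (disc K (u - x) (w - x * x)))
      ≡⟨ ∑ₚ-*ˡ c (λ x → ν (disc K (u - x) (w - x * x))) ⟩
    c * ∑ₚ (λ x → ν (disc K (u - x) (w - x * x)))
      ≡⟨ cong (c *_) (∑ₚ-ν-disc K p∤K+1 u w) ⟩
    P ^ m * η p (σ m * K) * (P * η p (K * D))
      ≡⟨ ring (P ^ m) P (η p (σ m * K)) (η p (K * D)) ⟩
    P ^ suc m * (η p (σ m * K) * η p (K * D))
      ≡⟨ cong (P ^ suc m *_) (η-mul (σ m * K) (K * D)) ⟨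
    P ^ suc m * η p (σ m * K * (K * D))
      ≡⟨ cong (P ^ suc m *_) (trans (cong (η p) (ring′ (σ m) K D)) (η-square-mul {K} (σ m * D) p∤K)) ⟩
    P ^ suc m * η p (σ m * D)
      ≡⟨ Eₑ-p∤ m p∤K+1 u w ⟨
    Eₑ m (K + + 1) u w ∎
    where
    open ≡-Reasoning
    c = P ^ m * η p (σ m * K)
    D = disc (K + + 1) u w
    ring : ∀ a P h g → a * h * (P * g) ≡ P * a * (h * g)
    ring = solve-∀
    ring′ : ∀ s K D → s * K * (K * D) ≡ K * K * (s * D)
    ring′ = solve-∀

  ∑Eₒ : ∀ m K u w → ∑ₚ (λ x → Eₒ m K (u - x) (w - x * x)) ≡ Eₑ m (K + + 1) u w
  ∑Eₒ m K u w = by-divisibility (P ∣? K) (P ∣? (K + + 1))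
    where
    by-divisibility : Dec (P ∣ K) → Dec (P ∣ K + + 1) → ∑ₚ (λ x → Eₒ m K (u - x) (w - x * x)) ≡ Eₑ m (K + + 1) u w
    by-divisibility (yes p∣K) _           = ∑Eₒ-p∣K m K p∣K u w
    by-divisibility (no _)    (yes p∣K+1) = ∑Eₒ-p∣K+1 m K p∣K+1 u w
    by-divisibility (no p∤K)  (no p∤K+1)  = ∑Eₒ-units m K p∤K p∤K+1 u w

  ∑Eₑ-p∣K : ∀ m K → P ∣ K → ∀ u w → ∑ₚ (λ x → Eₑ m K (u - x) (w - x * x)) ≡ Eₒ (suc m) (K + + 1) u w
  ∑Eₑ-p∣K m K p∣K u w = begin
    ∑ₚ (λ x → Eₑ m K (u - x) (w - x * x))
      ≡⟨ ∑ₚ-cong (λ x → trans (Eₑ-p∣ m p∣K (u - x) (w - x * x)) (ring (P ^ suc m) (δ (u - x)) _ _)) ⟩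
    ∑ₚ (λ x → P ^ suc m * (δ (u - x) * h x))
      ≡⟨ ∑ₚ-*ˡ (P ^ suc m) (λ x → δ (u - x) * h x) ⟩
    P ^ suc m * ∑ₚ (λ x → δ (u - x) * h x)
      ≡⟨ cong (P ^ suc m *_) (∑ₚ-δ-sift h resp u) ⟩
    P ^ suc m * (ν (w - u * u) * η p (- σ m))
      ≡⟨ cong (P ^ suc m *_) (trans (ℤP.*-comm (ν (w - u * u)) (η p (- σ m))) (cong₂ _*_ η-factor ν-factor)) ⟩
    P ^ suc m * (η p (σ (suc m) * (K + + 1)) * ν (disc (K + + 1) u w))
      ≡⟨ ℤP.*-assoc (P ^ suc m) _ _ ⟨
    P ^ suc m * η p (σ (suc m) * (K + + 1)) * ν (disc (K + + 1) u w)
      ≡⟨ Eₒ-p∤ (suc m) (p∣K⇒p∤K+1 p∣K) u w ⟨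
    Eₒ (suc m) (K + + 1) u w ∎
    where
    open ≡-Reasoning
    h : ℤ → ℤ
    h x = ν (w - x * x) * η p (- σ m)
    resp : Respects≈ h
    resp x≈y = cong (_* η p (- σ m)) (ν-resp-≈ (+-cong (≈-refl {w}) (-‿cong (*-cong x≈y x≈y))))
    ring : ∀ a d n e → a * d * n * e ≡ a * (d * (n * e))
    ring = solve-∀
    ring′ : ∀ s K → - s - - + 1 * s * (K + + 1) ≡ s * K
    ring′ = solve-∀
    η-factor : η p (- σ m) ≡ η p (σ (suc m) * (K + + 1))
    η-factor = η-resp-≈ { - σ m} (≈-via (σ m) p∣K (ring′ (σ m) K))
    ν-factor : ν (w - u * u) ≡ ν (disc (K + + 1) u w)
    ν-factor = ν-resp-≈ (≈-sym (disc-p∣K K p∣K u w))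

  ∑Eₑ-p∣K+1 : ∀ m K → P ∣ K + + 1 → ∀ u w → ∑ₚ (λ x → Eₑ m K (u - x) (w - x * x)) ≡ Eₒ (suc m) (K + + 1) u w
  ∑Eₑ-p∣K+1 m K p∣K+1 u w = begin
    ∑ₚ (λ x → Eₑ m K (u - x) (w - x * x))
      ≡⟨ ∑ₚ-cong (λ x → Eₑ-p∤ m p∤K (u - x) (w - x * x)) ⟩
    ∑ₚ (λ x → P ^ suc m * η p (σ m * disc K (u - x) (w - x * x)))
      ≡⟨ ∑ₚ-*ˡ (P ^ suc m) (λ x → η p (σ m * disc K (u - x) (w - x * x))) ⟩
    P ^ suc m * ∑ₚ (λ x → η p (σ m * disc K (u - x) (w - x * x)))
      ≡⟨ cong (P ^ suc m *_) (∑ₚ-η-disc-p∣K+1 K (p∤σ m) p∣K+1 u w) ⟩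
    P ^ suc m * (P * (δ u * η p (- σ m * w)))
      ≡⟨ trans (ring (P ^ suc m) P (δ u) (η p (- σ m * w))) (cong (λ s → P ^ suc (suc m) * δ u * η p s) (ring′ (σ m) w)) ⟩
    P ^ suc (suc m) * δ u * η p (σ (suc m) * w)
      ≡⟨ Eₒ-p∣ (suc m) p∣K+1 u w ⟨
    Eₒ (suc m) (K + + 1) u w ∎
    where
    open ≡-Reasoning
    p∤K : ¬ P ∣ K
    p∤K p∣K = p∣K⇒p∤K+1 p∣K p∣K+1
    ring : ∀ a P d h → a * (P * (d * h)) ≡ P * a * d * h
    ring = solve-∀
    ring′ : ∀ s w → - s * w ≡ - + 1 * s * w
    ring′ = solve-∀

  ∑Eₑ-units : ∀ m K → ¬ P ∣ K → ¬ P ∣ K + + 1 → ∀ u w →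
    ∑ₚ (λ x → Eₑ m K (u - x) (w - x * x)) ≡ Eₒ (suc m) (K + + 1) u w
  ∑Eₑ-units m K p∤K p∤K+1 u w = begin
    ∑ₚ (λ x → Eₑ m K (u - x) (w - x * x))
      ≡⟨ ∑ₚ-cong (λ x → Eₑ-p∤ m p∤K (u - x) (w - x * x)) ⟩
    ∑ₚ (λ x → P ^ suc m * η p (σ m * disc K (u - x) (w - x * x)))
      ≡⟨ ∑ₚ-*ˡ (P ^ suc m) (λ x → η p (σ m * disc K (u - x) (w - x * x))) ⟩
    P ^ suc m * ∑ₚ (λ x → η p (σ m * disc K (u - x) (w - x * x)))
      ≡⟨ cong (P ^ suc m *_) (∑ₚ-η-disc K (p∤σ m) p∤K p∤K+1 u w) ⟩
    P ^ suc m * (η p (- σ m * (K + + 1)) * ν (disc (K + + 1) u w))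
      ≡⟨ ℤP.*-assoc (P ^ suc m) _ _ ⟨
    P ^ suc m * η p (- σ m * (K + + 1)) * ν (disc (K + + 1) u w)
      ≡⟨ cong (λ s → P ^ suc m * η p (s * (K + + 1)) * ν (disc (K + + 1) u w)) (sym (ℤP.-1*i≡-i (σ m))) ⟩
    P ^ suc m * η p (σ (suc m) * (K + + 1)) * ν (disc (K + + 1) u w)
      ≡⟨ Eₒ-p∤ (suc m) p∤K+1 u w ⟨
    Eₒ (suc m) (K + + 1) u w ∎
    where open ≡-Reasoning

  ∑Eₑ : ∀ m K u w → ∑ₚ (λ x → Eₑ m K (u - x) (w - x * x)) ≡ Eₒ (suc m) (K + + 1) u w
  ∑Eₑ m K u w = by-divisibility (P ∣? K) (P ∣? (K + + 1))
    where
    by-divisibility : Dec (P ∣ K) → Dec (P ∣ K + + 1) → ∑ₚ (λ x → Eₑ m K (u - x) (w - x * x)) ≡ Eₒ (suc m) (K + + 1) u w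
    by-divisibility (yes p∣K) _           = ∑Eₑ-p∣K m K p∣K u w
    by-divisibility (no _)    (yes p∣K+1) = ∑Eₑ-p∣K+1 m K p∣K+1 u w
    by-divisibility (no p∤K)  (no p∤K+1)  = ∑Eₑ-units m K p∤K p∤K+1 u w

  η-one : η p (+ 1) ≡ + 1
  η-one = η-residue p∤1 (+ 1 , ≈-refl)

  reps-one : ∀ u w → P * reps 1 u w ≡ P ^ 0 + Eₒ 0 (+ 1) u w
  reps-one u w = begin
    P * reps 1 u w
      ≡⟨ cong (P *_) (reps-suc 0 u w) ⟩
    P * ∑ₚ (λ x → reps 0 (u - x) (w - x * x))
      ≡⟨ cong (P *_) (∑ₚ-cong (λ x → trans (reps-zero (u - x) (w - x * x))
                                            (cong (_* h x) (trans (cong δ (ring₁ u x)) (δ-neg (u - x)))))) ⟩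
    P * ∑ₚ (λ x → δ (u - x) * h x)
      ≡⟨ cong (P *_) (∑ₚ-δ-sift h resp u) ⟩
    P * δ (+ 0 - (w - u * u))
      ≡⟨ cong (P *_) (trans (cong δ (ring₂ u w)) (δ-neg (disc (+ 1) u w))) ⟩
    P * δ (disc (+ 1) u w)
      ≡⟨ ring₃ P (δ (disc (+ 1) u w)) ⟩
    + 1 + + 1 * + 1 * ν (disc (+ 1) u w)
      ≡⟨ cong (λ e → + 1 + + 1 * e * ν (disc (+ 1) u w)) η-one ⟨
    + 1 + + 1 * η p (+ 1) * ν (disc (+ 1) u w)
      ≡⟨ cong (_+_ (+ 1)) (Eₒ-p∤ 0 p∤1 u w) ⟨
    + 1 + Eₒ 0 (+ 1) u w ∎
    where
    open ≡-Reasoning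
    h : ℤ → ℤ
    h x = δ (+ 0 - (w - x * x))
    resp : Respects≈ h
    resp x≈y = δ-resp-≈ (+-cong (≈-refl {+ 0}) (-‿cong (+-cong (≈-refl {w}) (-‿cong (*-cong x≈y x≈y)))))
    ring₁ : ∀ u x → + 0 - (u - x) ≡ - (u - x)
    ring₁ = solve-∀
    ring₂ : ∀ u w → + 0 - (w - u * u) ≡ - (+ 1 * w - u * u)
    ring₂ = solve-∀
    ring₃ : ∀ P d → P * d ≡ + 1 + + 1 * + 1 * (P * d - + 1)
    ring₃ = solve-∀

  reps-odd : ∀ m u w → P * reps (suc (2 ℕ.* m)) u w ≡ P ^ (2 ℕ.* m) + Eₒ m (+ suc (2 ℕ.* m)) u w
  reps-even : ∀ m u w → P * reps (2 ℕ.+ 2 ℕ.* m) u w ≡ P ^ suc (2 ℕ.* m) + Eₑ m (+ (2 ℕ.+ 2 ℕ.* m)) u w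

  reps-odd zero    u w = reps-one u w
  reps-odd (suc m) u w =
    subst (λ n → P * reps (suc n) u w ≡ P ^ n + Eₒ (suc m) (+ suc n) u w) (sym (2*suc m))
      (trans (reps-step (2 ℕ.+ 2 ℕ.* m) (suc (2 ℕ.* m)) (Eₑ m (+ (2 ℕ.+ 2 ℕ.* m))) (reps-even m) u w)
             (cong (_+_ (P ^ (2 ℕ.+ 2 ℕ.* m))) (trans (∑Eₑ m (+ (2 ℕ.+ 2 ℕ.* m)) u w) (cong (λ K → Eₒ (suc m) K u w) (pos-+1 _)))))

  reps-even m u w =
    trans (reps-step (suc (2 ℕ.* m)) (2 ℕ.* m) (Eₒ m (+ suc (2 ℕ.* m))) (reps-odd m) u w)
          (cong (_+_ (P ^ suc (2 ℕ.* m))) (trans (∑Eₒ m (+ suc (2 ℕ.* m)) u w) (cong (λ K → Eₑ m K u w) (pos-+1 _))))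

  %≡ᵇ0≡does-p∣ : ∀ n → (n % p ≡ᵇ 0) ≡ does (P ∣? + n)
  %≡ᵇ0≡does-p∣ n =
    does-⇔ (mk⇔ (∣ᵤ⇒∣ ∘ ℕD.m%n≡0⇒n∣m n p) (ℕD.n∣m⇒m%n≡0 n p ∘ ∣⇒∣ᵤ)) (n % p ℕ.≟ 0) (P ∣? + n)

  -- e₁² = 2e₂ + Σaᵢ² and 2 is invertible mod p.
  p∣e₂⇔p∣sumSq : ∀ {k} (v : Vec ℕ k) → P ∣ + e₁ v → (P ∣ + e₂ v ⇔ P ∣ + sumSq v)
  p∣e₂⇔p∣sumSq v p∣e₁ = mk⇔
    (λ p∣e₂ → subst (P ∣_) (trans (cong (_- 2e₂) identity) (ring₁ 2e₂ sq)) (∣m∣n⇒∣m-n p∣e₁² (∣n⇒∣m*n (+ 2) p∣e₂)))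
    (λ p∣sq → p∣*-cancelˡ p∤2 (subst (P ∣_) (trans (cong (_- sq) identity) (ring₂ 2e₂ sq)) (∣m∣n⇒∣m-n p∣e₁² p∣sq)))
    where
    e₁² = + e₁ v * + e₁ v
    2e₂ = + 2 * + e₂ v
    sq = + sumSq v
    p∣e₁² : P ∣ e₁²
    p∣e₁² = ∣m⇒∣m*n (+ e₁ v) p∣e₁
    identity : e₁² ≡ 2e₂ + sq
    identity = begin
      + e₁ v * + e₁ v                ≡⟨ ℤP.pos-* (e₁ v) (e₁ v) ⟨
      + (e₁ v ℕ.* e₁ v)              ≡⟨ cong +_ (e₁²≡2e₂+sumSq v) ⟩
      + (2 ℕ.* e₂ v ℕ.+ sumSq v)     ≡⟨ ℤP.pos-+ (2 ℕ.* e₂ v) (sumSq v) ⟩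
      + (2 ℕ.* e₂ v) + + sumSq v     ≡⟨ cong (_+ + sumSq v) (ℤP.pos-* 2 (e₂ v)) ⟩
      + 2 * + e₂ v + + sumSq v       ∎
      where open ≡-Reasoning
    ring₁ : ∀ b c → b + c - b ≡ c
    ring₁ = solve-∀
    ring₂ : ∀ b c → b + c - c ≡ b
    ring₂ = solve-∀

  N≡reps : ∀ k → + N k p ≡ reps k (+ 0) (+ 0)
  N≡reps k = cong +_ (count-cong p k condition)
    where
    ∧-congˡ-dec : ∀ {A : Set} (a? : Dec A) {x y} → (A → x ≡ y) → does a? ∧ x ≡ does a? ∧ y
    ∧-congˡ-dec (yes a) x≡y = x≡y a
    ∧-congˡ-dec (no _)  _   = refl
    minus-0 : ∀ n → does (P ∣? + n) ≡ does (P ∣? (+ n - + 0))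
    minus-0 n = cong (does ∘ (P ∣?_)) (sym (ℤP.+-identityʳ (+ n)))
    condition : ∀ (v : Vec ℕ k) → ((e₁ v % p ≡ᵇ 0) ∧ (e₂ v % p ≡ᵇ 0)) ≡ hits (+ 0) (+ 0) v
    condition v = begin
      (e₁ v % p ≡ᵇ 0) ∧ (e₂ v % p ≡ᵇ 0)
        ≡⟨ cong₂ _∧_ (%≡ᵇ0≡does-p∣ (e₁ v)) (%≡ᵇ0≡does-p∣ (e₂ v)) ⟩
      does (P ∣? + e₁ v) ∧ does (P ∣? + e₂ v)
        ≡⟨ ∧-congˡ-dec (P ∣? + e₁ v) (λ p∣e₁ → does-⇔ (p∣e₂⇔p∣sumSq v p∣e₁) (P ∣? + e₂ v) (P ∣? + sumSq v)) ⟩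
      does (P ∣? + e₁ v) ∧ does (P ∣? + sumSq v)
        ≡⟨ cong₂ _∧_ (minus-0 (e₁ v)) (minus-0 (sumSq v)) ⟩
      hits (+ 0) (+ 0) v ∎
      where open ≡-Reasoning

  gcd-p∣ : ∀ {k} → P ∣ + k → gcd k p ≡ p
  gcd-p∣ {k} p∣k = ℕD.∣-antisym (gcd[m,n]∣n k p) (gcd-greatest (∣⇒∣ᵤ p∣k) ℕD.∣-refl)

  gcd-p∤ : ∀ {k} → ¬ P ∣ + k → gcd k p ≡ 1
  gcd-p∤ p∤k = coprime⇒gcd≡1 (coprime p∤k)

  p∣disc-origin : ∀ K → P ∣ disc K (+ 0) (+ 0)
  p∣disc-origin K = subst (P ∣_) (sym (ring K)) p∣0
    where ring : ∀ K → K * + 0 - + 0 * + 0 ≡ + 0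
          ring = solve-∀

  Eₒ-origin : ∀ m K → Eₒ m K (+ 0) (+ 0) ≡ (P - + 1) * P ^ m * η p (σ m * K)
  Eₒ-origin m K = by-divisibility (P ∣? K)
    where
    open ≡-Reasoning
    by-divisibility : Dec (P ∣ K) → Eₒ m K (+ 0) (+ 0) ≡ (P - + 1) * P ^ m * η p (σ m * K)
    by-divisibility (yes p∣K) = begin
      Eₒ m K (+ 0) (+ 0)                      ≡⟨ Eₒ-p∣ m p∣K (+ 0) (+ 0) ⟩
      P ^ suc m * δ (+ 0) * η p (σ m * + 0)   ≡⟨ cong (P ^ suc m * δ (+ 0) *_) (η-p∣ (∣n⇒∣m*n (σ m) p∣0)) ⟩
      P ^ suc m * δ (+ 0) * + 0               ≡⟨ ℤP.*-zeroʳ (P ^ suc m * δ (+ 0)) ⟩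
      + 0                                     ≡⟨ ℤP.*-zeroʳ ((P - + 1) * P ^ m) ⟨
      (P - + 1) * P ^ m * + 0                 ≡⟨ cong ((P - + 1) * P ^ m *_) (η-p∣ (∣n⇒∣m*n (σ m) p∣K)) ⟨
      (P - + 1) * P ^ m * η p (σ m * K)       ∎
    by-divisibility (no p∤K) = begin
      Eₒ m K (+ 0) (+ 0)                                ≡⟨ Eₒ-p∤ m p∤K (+ 0) (+ 0) ⟩
      P ^ m * η p (σ m * K) * ν (disc K (+ 0) (+ 0))    ≡⟨ cong (P ^ m * η p (σ m * K) *_) (ν-p∣ (p∣disc-origin K)) ⟩
      P ^ m * η p (σ m * K) * (P - + 1)                 ≡⟨ ring (P ^ m) (η p (σ m * K)) P ⟩
      (P - + 1) * P ^ m * η p (σ m * K)                 ∎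
      where ring : ∀ a h P → a * h * (P - + 1) ≡ (P - + 1) * a * h
            ring = solve-∀

  Eₑ-origin : ∀ m k → Eₑ m (+ k) (+ 0) (+ 0) ≡ (P - + 1) * P ^ suc m * η p (σ (suc m) * (+ 1 - + gcd k p))
  Eₑ-origin m k = by-divisibility (P ∣? + k)
    where
    open ≡-Reasoning
    c = (P - + 1) * P ^ suc m
    by-divisibility : Dec (P ∣ + k) → Eₑ m (+ k) (+ 0) (+ 0) ≡ (P - + 1) * P ^ suc m * η p (σ (suc m) * (+ 1 - + gcd k p))
    by-divisibility (yes p∣k) = begin
      Eₑ m (+ k) (+ 0) (+ 0)
        ≡⟨ Eₑ-p∣ m p∣k (+ 0) (+ 0) ⟩
      P ^ suc m * δ (+ 0) * ν (+ 0) * η p (- σ m)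
        ≡⟨ cong₂ (λ d n → P ^ suc m * d * n * η p (- σ m)) (δ-p∣ p∣0) (ν-p∣ p∣0) ⟩
      P ^ suc m * + 1 * (P - + 1) * η p (- σ m)
        ≡⟨ ring (P ^ suc m) P (η p (- σ m)) ⟩
      c * η p (- σ m)
        ≡⟨ cong (c *_) (η-resp-≈ { - σ m} (≈-via (- σ m) p∣P (ring′ (σ m) P))) ⟩
      c * η p (σ (suc m) * (+ 1 - P))
        ≡⟨ cong (λ g → c * η p (σ (suc m) * (+ 1 - + g))) (gcd-p∣ p∣k) ⟨
      c * η p (σ (suc m) * (+ 1 - + gcd k p)) ∎
      where ring : ∀ a P h → a * + 1 * (P - + 1) * h ≡ (P - + 1) * a * h
            ring = solve-∀
            ring′ : ∀ s P → - s - - + 1 * s * (+ 1 - P) ≡ - s * P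
            ring′ = solve-∀
    by-divisibility (no p∤k) = begin
      Eₑ m (+ k) (+ 0) (+ 0)
        ≡⟨ Eₑ-p∤ m p∤k (+ 0) (+ 0) ⟩
      P ^ suc m * η p (σ m * disc (+ k) (+ 0) (+ 0))
        ≡⟨ cong (P ^ suc m *_) (η-p∣ (∣n⇒∣m*n (σ m) (p∣disc-origin (+ k)))) ⟩
      P ^ suc m * + 0
        ≡⟨ trans (ℤP.*-zeroʳ (P ^ suc m)) (sym (ℤP.*-zeroʳ c)) ⟩
      c * + 0
        ≡⟨ cong (c *_) (η-p∣ (∣n⇒∣m*n (σ (suc m)) p∣0)) ⟨
      c * η p (σ (suc m) * (+ 1 - + 1))
        ≡⟨ cong (λ g → c * η p (σ (suc m) * (+ 1 - + g))) (gcd-p∤ p∤k) ⟨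
      c * η p (σ (suc m) * (+ 1 - + gcd k p)) ∎

  natural-form : ∀ a b h → + (p ℕ.^ a) + + ((p ℕ.∸ 1) ℕ.* p ℕ.^ b) * h ≡ P ^ a + (P - + 1) * P ^ b * h
  natural-form a b h =
    cong₂ _+_ (pos-^ p a) (cong (_* h) (trans (ℤP.pos-* (p ℕ.∸ 1) (p ℕ.^ b)) (cong (_*_ (P - + 1)) (pos-^ p b))))

  OddCount EvenCount : ℕ → Set
  OddCount k = + N k p ≡ + (p ℕ.^ (k ℕ.∸ 2)) + + ((p ℕ.∸ 1) ℕ.* p ℕ.^ ((k ℕ.∸ 3) / 2)) * η p (σ ((k ℕ.∸ 1) / 2) * + k)
  EvenCount k = + N k p ≡ + (p ℕ.^ (k ℕ.∸ 2)) + + ((p ℕ.∸ 1) ℕ.* p ℕ.^ ((k ℕ.∸ 2) / 2)) * η p (σ (k / 2) * (+ 1 - + gcd k p))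

  N-odd : ∀ m → OddCount (3 ℕ.+ 2 ℕ.* m)
  N-odd m = subst₂ (λ a b → + N k p ≡ + (p ℕ.^ suc (2 ℕ.* m)) + + ((p ℕ.∸ 1) ℕ.* p ℕ.^ a) * η p (σ b * + k))
                   (sym ([2m]/2≡m m)) (sym ([2+2m]/2≡1+m m)) (ℤP.*-cancelˡ-≡ P _ _ (begin
    P * + N k p
      ≡⟨ cong (P *_) (N≡reps k) ⟩
    P * reps k (+ 0) (+ 0)
      ≡⟨ subst (λ n → P * reps (suc n) (+ 0) (+ 0) ≡ P ^ n + Eₒ (suc m) (+ suc n) (+ 0) (+ 0)) (2*suc m) (reps-odd (suc m) (+ 0) (+ 0)) ⟩
    P ^ (2 ℕ.+ 2 ℕ.* m) + Eₒ (suc m) (+ k) (+ 0) (+ 0)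
      ≡⟨ cong (_+_ (P ^ (2 ℕ.+ 2 ℕ.* m))) (Eₒ-origin (suc m) (+ k)) ⟩
    P * P ^ suc (2 ℕ.* m) + (P - + 1) * (P * P ^ m) * h
      ≡⟨ ring P (P ^ suc (2 ℕ.* m)) (P ^ m) h ⟩
    P * (P ^ suc (2 ℕ.* m) + (P - + 1) * P ^ m * h)
      ≡⟨ cong (P *_) (natural-form (suc (2 ℕ.* m)) m h) ⟨
    P * (+ (p ℕ.^ suc (2 ℕ.* m)) + + ((p ℕ.∸ 1) ℕ.* p ℕ.^ m) * h) ∎))
    where
    open ≡-Reasoning
    k = 3 ℕ.+ 2 ℕ.* m
    h = η p (σ (suc m) * + k)
    ring : ∀ P a b h → P * a + (P - + 1) * (P * b) * h ≡ P * (a + (P - + 1) * b * h)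
    ring = solve-∀

  N-even : ∀ m → EvenCount (2 ℕ.+ 2 ℕ.* m)
  N-even m = subst₂ (λ a b → + N k p ≡ + (p ℕ.^ (2 ℕ.* m)) + + ((p ℕ.∸ 1) ℕ.* p ℕ.^ a) * η p (σ b * (+ 1 - + gcd k p)))
                    (sym ([2m]/2≡m m)) (sym ([2+2m]/2≡1+m m)) (ℤP.*-cancelˡ-≡ P _ _ (begin
    P * + N k p
      ≡⟨ cong (P *_) (N≡reps k) ⟩
    P * reps k (+ 0) (+ 0)
      ≡⟨ reps-even m (+ 0) (+ 0) ⟩
    P ^ suc (2 ℕ.* m) + Eₑ m (+ k) (+ 0) (+ 0)
      ≡⟨ cong (_+_ (P ^ suc (2 ℕ.* m))) (Eₑ-origin m k) ⟩
    P * P ^ (2 ℕ.* m) + (P - + 1) * (P * P ^ m) * h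
      ≡⟨ ring P (P ^ (2 ℕ.* m)) (P ^ m) h ⟩
    P * (P ^ (2 ℕ.* m) + (P - + 1) * P ^ m * h)
      ≡⟨ cong (P *_) (natural-form (2 ℕ.* m) m h) ⟨
    P * (+ (p ℕ.^ (2 ℕ.* m)) + + ((p ℕ.∸ 1) ℕ.* p ℕ.^ m) * h) ∎))
    where
    open ≡-Reasoning
    k = 2 ℕ.+ 2 ℕ.* m
    h = η p (σ (suc m) * (+ 1 - + gcd k p))
    ring : ∀ P a b h → P * a + (P - + 1) * (P * b) * h ≡ P * (a + (P - + 1) * b * h)
    ring = solve-∀

  odd-count : ∀ k → 1 < k → k % 2 ≡ 1 → OddCount k
  odd-count k 1<k k%2≡1 = subst OddCount (sym (proj₂ decomposition)) (N-odd (proj₁ decomposition))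
    where decomposition = odd-decomposition k 1<k k%2≡1

  even-count : ∀ k → 1 < k → k % 2 ≡ 0 → EvenCount k
  even-count k 1<k k%2≡0 = subst EvenCount (sym (proj₂ decomposition)) (N-even (proj₁ decomposition))
    where decomposition = even-decomposition k 1<k k%2≡0

  count-formula : ∀ k → 1 < k → (k % 2 ≡ 1 → OddCount k) × (k % 2 ≡ 0 → EvenCount k)
  count-formula k 1<k = odd-count k 1<k , even-count k 1<k

even? : ℕ → Bool
even? n = n % 2 ≡ᵇ 0

even?-2+ : ∀ n → even? (2 ℕ.+ n) ≡ even? n
even?-2+ n = cong (_≡ᵇ 0) (trans (cong (_% 2) (ℕP.+-comm 2 n)) (ℕDM.[m+n]%n≡m%n n 2))

even?-double+ : ∀ e n → even? (e ℕ.+ e ℕ.+ n) ≡ even? n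
even?-double+ e n = cong (_≡ᵇ 0) (trans (cong (_% 2) (ring e n)) (ℕDM.[m+kn]%n≡m%n n e 2))
  where ring : ∀ e n → e ℕ.+ e ℕ.+ n ≡ n ℕ.+ e ℕ.* 2
        ring = ℕSolver.solve-∀

-- For a 0/1-tuple with t ones, e₁ = t and e₂ = t(t−1)/2, so (e₁, e₂) mod 2 determines t mod 4;
-- class j collects the tuples with t ≡ −j (mod 4), and class 0 is the one counted by N k 2.
weightClass : Fin 4 → ∀ {k} → Vec ℕ k → Bool
weightClass 0F v = even? (e₁ v) ∧ even? (e₂ v)
weightClass 1F v = even? (suc (e₁ v)) ∧ even? (e₁ v ℕ.+ e₂ v)
weightClass 2F v = even? (e₁ v) ∧ even? (suc (e₂ v))
weightClass 3F v = even? (suc (e₁ v)) ∧ even? (suc (e₁ v ℕ.+ e₂ v))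

classCount : Fin 4 → ℕ → ℤ
classCount j k = + count 2 k (weightClass j)

0∷-class : ∀ j {k} (v : Vec ℕ k) → weightClass j (0 ∷ v) ≡ weightClass j v
0∷-class 0F v = refl
0∷-class 1F v = refl
0∷-class 2F v = refl
0∷-class 3F v = refl

1∷-class₀ : ∀ {k} (v : Vec ℕ k) → weightClass 0F (1 ∷ v) ≡ weightClass 1F v
1∷-class₀ v = cong (λ e → even? (suc (e₁ v)) ∧ even? (e ℕ.+ e₂ v)) (ℕP.+-identityʳ (e₁ v))

1∷-class₁ : ∀ {k} (v : Vec ℕ k) → weightClass 1F (1 ∷ v) ≡ weightClass 2F v
1∷-class₁ v = cong₂ _∧_ (even?-2+ (e₁ v)) (trans (cong even? (ring (e₁ v) (e₂ v))) (even?-double+ (e₁ v) (suc (e₂ v))))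
  where ring : ∀ e f → suc e ℕ.+ (e ℕ.+ 0 ℕ.+ f) ≡ e ℕ.+ e ℕ.+ suc f
        ring = ℕSolver.solve-∀

1∷-class₂ : ∀ {k} (v : Vec ℕ k) → weightClass 2F (1 ∷ v) ≡ weightClass 3F v
1∷-class₂ v = cong (λ e → even? (suc (e₁ v)) ∧ even? (suc (e ℕ.+ e₂ v))) (ℕP.+-identityʳ (e₁ v))

1∷-class₃ : ∀ {k} (v : Vec ℕ k) → weightClass 3F (1 ∷ v) ≡ weightClass 0F v
1∷-class₃ v = cong₂ _∧_ (even?-2+ (e₁ v))
  (trans (cong even? (ring (e₁ v) (e₂ v))) (trans (even?-double+ (e₁ v) (2 ℕ.+ e₂ v)) (even?-2+ (e₂ v))))
  where ring : ∀ e f → suc (suc e ℕ.+ (e ℕ.+ 0 ℕ.+ f)) ≡ e ℕ.+ e ℕ.+ (2 ℕ.+ f)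
        ring = ℕSolver.solve-∀

classCount-suc : ∀ j j′ k → (∀ {n} (v : Vec ℕ n) → weightClass j (1 ∷ v) ≡ weightClass j′ v) →
  classCount j (suc k) ≡ classCount j k + classCount j′ k
classCount-suc j j′ k 1∷-class = trans (count-suc 2 k (weightClass j))
  (cong₂ _+_ (cong +_ (count-cong 2 k (0∷-class j)))
             (trans (ℤP.+-identityʳ _) (cong +_ (count-cong 2 k 1∷-class))))

re im : ℕ → ℤ
re k = ℤ[i].re (powOnePlusI k)
im k = ℤ[i].im (powOnePlusI k)

-- Uniformly in j: 4 · classCount j k = 2^k + 2 · Re (iʲ (1 + i)^k).
record ClassCounts (k : ℕ) : Set where
  field
    class₀ : + 4 * classCount 0F k ≡ + (2 ℕ.^ k) + + 2 * re k
    class₁ : + 4 * classCount 1F k ≡ + (2 ℕ.^ k) - + 2 * im k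
    class₂ : + 4 * classCount 2F k ≡ + (2 ℕ.^ k) - + 2 * re k
    class₃ : + 4 * classCount 3F k ≡ + (2 ℕ.^ k) + + 2 * im k

classCounts-step : ∀ k → ClassCounts k → ClassCounts (suc k)
classCounts-step k counts = record
  { class₀ = step 0F 1F 1∷-class₀ (+ 2 * re (suc k)) class₀ class₁ (ring₀ 2^k (re k) (im k))
  ; class₁ = step 1F 2F 1∷-class₁ (- (+ 2 * im (suc k))) class₁ class₂ (ring₁ 2^k (re k) (im k))
  ; class₂ = step 2F 3F 1∷-class₂ (- (+ 2 * re (suc k))) class₂ class₃ (ring₂ 2^k (re k) (im k))
  ; class₃ = step 3F 0F 1∷-class₃ (+ 2 * im (suc k)) class₃ class₀ (ring₃ 2^k (re k) (im k))
  }
  where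
  open ClassCounts counts
  2^k : ℤ
  2^k = + (2 ℕ.^ k)
  2^suc : + (2 ℕ.^ suc k) ≡ 2^k + 2^k
  2^suc = trans (cong (λ n → + (2 ℕ.^ k ℕ.+ n)) (ℕP.+-identityʳ (2 ℕ.^ k))) (ℤP.pos-+ (2 ℕ.^ k) (2 ℕ.^ k))
  step : ∀ j j′ → (∀ {n} (v : Vec ℕ n) → weightClass j (1 ∷ v) ≡ weightClass j′ v) →
         ∀ z {x y} → + 4 * classCount j k ≡ x → + 4 * classCount j′ k ≡ y → x + y ≡ 2^k + 2^k + z →
         + 4 * classCount j (suc k) ≡ + (2 ℕ.^ suc k) + z
  step j j′ 1∷-class z {x} {y} ≡x ≡y x+y≡ = begin
    + 4 * classCount j (suc k)                    ≡⟨ cong (_*_ (+ 4)) (classCount-suc j j′ k 1∷-class) ⟩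
    + 4 * (classCount j k + classCount j′ k)      ≡⟨ ℤP.*-distribˡ-+ (+ 4) (classCount j k) (classCount j′ k) ⟩
    + 4 * classCount j k + + 4 * classCount j′ k  ≡⟨ cong₂ _+_ ≡x ≡y ⟩
    x + y                                         ≡⟨ x+y≡ ⟩
    2^k + 2^k + z                                 ≡⟨ cong (_+ z) 2^suc ⟨
    + (2 ℕ.^ suc k) + z                           ∎
    where open ≡-Reasoning
  ring₀ : ∀ T a b → T + + 2 * a + (T - + 2 * b) ≡ T + T + + 2 * (+ 1 * a - + 1 * b)
  ring₀ = solve-∀
  ring₁ : ∀ T a b → T - + 2 * b + (T - + 2 * a) ≡ T + T - + 2 * (+ 1 * b + + 1 * a)
  ring₁ = solve-∀
  ring₂ : ∀ T a b → T - + 2 * a + (T + + 2 * b) ≡ T + T - + 2 * (+ 1 * a - + 1 * b)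
  ring₂ = solve-∀
  ring₃ : ∀ T a b → T + + 2 * b + (T + + 2 * a) ≡ T + T + + 2 * (+ 1 * b + + 1 * a)
  ring₃ = solve-∀

classCounts : ∀ k → ClassCounts (suc k)
classCounts zero    = record { class₀ = refl ; class₁ = refl ; class₂ = refl ; class₃ = refl }
classCounts (suc k) = classCounts-step (suc k) (classCounts k)

N-two : ∀ {k} → 0 < k → + (4 ℕ.* N k 2) ≡ + (2 ℕ.^ k) + + 2 * sqrt2PowCos k
N-two {suc k} _ = trans (ℤP.pos-* 4 (N (suc k) 2)) (ClassCounts.class₀ (classCounts k))

mainTheorem4 : (k : ℕ) → 1 < k →
    ((p : ℕ) → Prime p → 2 < p →
      (k % 2 ≡ 1 →
        + N k p ≡ + (p ℕ.^ (k ℕ.∸ 2))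
          ℤ.+ + ((p ℕ.∸ 1) ℕ.* p ℕ.^ ((k ℕ.∸ 3) / 2))
              ℤ.* η p ((- (+ 1)) ℤ.^ ((k ℕ.∸ 1) / 2) ℤ.* + k))
      × (k % 2 ≡ 0 →
        + N k p ≡ + (p ℕ.^ (k ℕ.∸ 2))
          ℤ.+ + ((p ℕ.∸ 1) ℕ.* p ℕ.^ ((k ℕ.∸ 2) / 2))
              ℤ.* η p ((- (+ 1)) ℤ.^ (k / 2) ℤ.* (+ 1 ℤ.- + gcd k p))))
    × (+ (4 ℕ.* N k 2) ≡ + (2 ℕ.^ k) ℤ.+ + 2 ℤ.* sqrt2PowCos k)
mainTheorem4 k 1<k =
  (λ { zero _ () ; (suc q) p-prime 2<p → OddPrime.count-formula q p-prime 2<p k 1<k })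
  , N-two (ℕP.<⇒≤ 1<k)
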